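{- Define integers $B'(n)$, $n\ge1$, by \[ \sum_{n=1}^\infty B'(n) q^n := \sum_{n=1}^\infty q^{n}(-q^{n+1};q)_\infty^2 (q^{n+1};q)_\infty (q^{n+1};q)_{n}. \] Then \[ \sum_{n=1}^\infty q^{n}(-q^{n+1};q)_\infty^2 (q^{n+1};q)_\infty (q^{n+1};q)_{n} = \Big(\sum_{n=0}^\infty q^{\frac{n(n+1)}{2}} \Big)^2 - \sum_{n=0}^\infty q^{\frac{n(n+1)}{2}}. \]
   Context: Here $q$ is a complex number with $|q|<1$ (equivalently, identities of formal power series in $q$). Notation: $(a;q)_0=1$, $(a;q)_n=\prod_{j=0}^{n-1}(1-aq^j)$, $(a;q)_\infty=\prod_{j=0}^{\infty}(1-aq^j)$, and $(a;q)_\infty^k$ denotes the $k$-th power of $(a;q)_\infty$. -}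

module Defs where

open import Data.Nat using (ℕ; zero; suc; _∸_; _≡ᵇ_; ⌊_/2⌋) renaming (_+_ to _+ℕ_; _*_ to _*ℕ_)
open import Data.Integer using (ℤ; 0ℤ; 1ℤ; -1ℤ; _+_; _-_; _*_)
open import Data.Bool using (if_then_else_)

-- Formal power series in q with integer coefficients: n ↦ coefficient of q^n.
Series : Set
Series = ℕ → ℤ

sumTo : ℕ → (ℕ → ℤ) → ℤ
sumTo zero    h = h 0
sumTo (suc n) h = sumTo n h + h (suc n)

_⊕_ : Series → Series → Series
(f ⊕ g) n = f n + g n

_⊖_ : Series → Series → Series
(f ⊖ g) n = f n - g n

_⊛_ : Series → Series → Series
(f ⊛ g) n = sumTo n (λ k → f k * g (n ∸ k))

infixl 7 _⊛_
infixl 6 _⊕_ _⊖_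

mono : ℤ → ℕ → Series
mono c m n = if m ≡ᵇ n then c else 0ℤ

one : Series
one = mono 1ℤ 0

finProd : ℕ → (ℕ → Series) → Series
finProd zero    F = one
finProd (suc k) F = finProd k F ⊛ F k

pochFin : ℤ → ℕ → ℕ → Series
pochFin c m k = finProd k (λ j → one ⊖ mono c (m +ℕ j))

-- (c q^m ; q)_∞ for m ≥ 1: the coefficient of q^N only depends on the
-- factors with j ≤ N (all others are 1 mod q^{N+1}), so it is the
-- coefficient of q^N in the finite product over j < N+1.
pochInf : ℤ → ℕ → Series
pochInf c m N = pochFin c m (suc N) N

-- Σ_{n≥0} F n for a family with F n ≡ 0 mod q^n (order ≥ n): the
-- coefficient of q^N is the finite sum Σ_{n≤N} [q^N] F n.
infSum : (ℕ → Series) → Series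
infSum F N = sumTo N (λ n → F n N)

lhsTerm : ℕ → Series
lhsTerm n = mono 1ℤ n ⊛ pochInf -1ℤ (suc n) ⊛ pochInf -1ℤ (suc n)
              ⊛ pochInf 1ℤ (suc n) ⊛ pochFin 1ℤ (suc n) n

B′ : Series
B′ = infSum (λ n → lhsTerm (suc n))

psi : Series
psi = infSum (λ n → mono 1ℤ ⌊ n *ℕ suc n /2⌋)

{-# OPTIONS --safe #-}
module Submission where

-- Write E = (-q;q)∞ and Q = (q²;q²)∞.  Splitting (q^(n+1);q)ₙ = (q;q²)ₙ (-q;q)ₙ and using
-- (-q^(n+1);q)∞ (-q;q)ₙ = E and (-q^(n+1);q)∞ (q^(n+1);q)∞ = (q^(2n+2);q²)∞ shows that the series
-- is E (A 0 - Q), where A k = Σₙ q^((2k+1)n) (q;q²)ₙ (q^(2n+2);q²)∞.  Comparing A k and A (k+1) term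
-- by term gives (1 - q^(2k+1)) A k = (1 - q^(2k+2)) A (k+1), so D k = (q^(2k+1);q²)∞ A k - Q (q^(2k+2);q²)∞
-- satisfies D k = (1 - q^(2k+2)) D (k+1); as q^(k+1) divides D k, D 0 = 0.  With Euler's identity
-- E (q;q²)∞ = 1 this gives A 0 = E Q², so the series is (EQ)² - EQ, and EQ = ψ is Gauss's identity.
-- The latter is the limit M → ∞ of the finite Jacobi triple product
-- Σ_{a+b=2M} [2M choose a] q^t(a-M) = (-q;q)_M (-1;q)_M, t(x) = x(x+1)/2, multiplied by (q;q)∞:
-- (q;q)∞ [a+b choose a] ≡ 1 modulo q^(min(a,b)+1), and t(a-M) is large unless a and b are.

open import Defs
open import Data.Nat as ℕ using (ℕ; zero; suc; _∸_; _≤_; _<_; z≤n; s≤s; ⌊_/2⌋)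
import Data.Nat.Properties as ℕₚ
open import Data.Nat.Tactic.RingSolver using (solve-∀)
open import Data.Integer as ℤ using (ℤ; 0ℤ; 1ℤ; -1ℤ; _+_; _-_; _*_; -_)
import Data.Integer.Properties as ℤₚ
open import Data.Bool using (true; false; if_then_else_)
open import Data.Empty using (⊥-elim)
open import Data.Maybe using (Maybe; just; nothing)
open import Data.Product using (_,_)
open import Data.Sum using (inj₁; inj₂)
open import Function using (_∘_)
open import Level using (0ℓ)
open import Relation.Nullary using (yes; no)
open import Relation.Binary.PropositionalEquality
open import Relation.Binary.Bundles using (Setoid)
open import Algebra.Bundles using (CommutativeRing)
open import Algebra.Structures using (IsCommutativeRing)
import Algebra.Solver.Ring.AlmostCommutativeRing as ACR
import Algebra.Solver.Ring
import Relation.Binary.Reasoning.Setoid as SetoidReasoning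
open import Algebra.Properties.CommutativeSemigroup ℤₚ.+-commutativeSemigroup
  using () renaming (interchange to +-interchange)

-- Finite sums

sumTo-cong : ∀ n {f g : ℕ → ℤ} → (∀ k → k ≤ n → f k ≡ g k) → sumTo n f ≡ sumTo n g
sumTo-cong zero    f≗g = f≗g 0 z≤n
sumTo-cong (suc n) f≗g =
  cong₂ _+_ (sumTo-cong n (λ k k≤n → f≗g k (ℕₚ.m≤n⇒m≤1+n k≤n))) (f≗g (suc n) ℕₚ.≤-refl)

sumTo-zero : ∀ n {f : ℕ → ℤ} → (∀ k → k ≤ n → f k ≡ 0ℤ) → sumTo n f ≡ 0ℤ
sumTo-zero zero    f≗0 = f≗0 0 z≤n
sumTo-zero (suc n) f≗0 =
  cong₂ _+_ (sumTo-zero n (λ k k≤n → f≗0 k (ℕₚ.m≤n⇒m≤1+n k≤n))) (f≗0 (suc n) ℕₚ.≤-refl)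

sumTo-distrib-+ : ∀ n (f g : ℕ → ℤ) → sumTo n (λ k → f k + g k) ≡ sumTo n f + sumTo n g
sumTo-distrib-+ zero    f g = refl
sumTo-distrib-+ (suc n) f g rewrite sumTo-distrib-+ n f g =
  +-interchange (sumTo n f) (sumTo n g) (f (suc n)) (g (suc n))

sumTo-neg : ∀ n (f : ℕ → ℤ) → sumTo n (λ k → - f k) ≡ - sumTo n f
sumTo-neg zero    f = refl
sumTo-neg (suc n) f rewrite sumTo-neg n f = sym (ℤₚ.neg-distrib-+ (sumTo n f) (f (suc n)))

sumTo-*ˡ : ∀ n c (f : ℕ → ℤ) → sumTo n (λ k → c * f k) ≡ c * sumTo n f
sumTo-*ˡ zero    c f = refl
sumTo-*ˡ (suc n) c f rewrite sumTo-*ˡ n c f = sym (ℤₚ.*-distribˡ-+ c (sumTo n f) (f (suc n)))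

sumTo-*ʳ : ∀ n c (f : ℕ → ℤ) → sumTo n (λ k → f k * c) ≡ sumTo n f * c
sumTo-*ʳ zero    c f = refl
sumTo-*ʳ (suc n) c f rewrite sumTo-*ʳ n c f = sym (ℤₚ.*-distribʳ-+ c (sumTo n f) (f (suc n)))

sumTo-suc : ∀ n (f : ℕ → ℤ) → sumTo (suc n) f ≡ f 0 + sumTo n (f ∘ suc)
sumTo-suc zero    f = refl
sumTo-suc (suc n) f rewrite sumTo-suc n f = ℤₚ.+-assoc (f 0) (sumTo n (f ∘ suc)) (f (suc (suc n)))

sumTo-+ : ∀ m n (f : ℕ → ℤ) → sumTo (suc (m ℕ.+ n)) f ≡ sumTo m f + sumTo n (λ j → f (suc (m ℕ.+ j)))
sumTo-+ m zero    f rewrite ℕₚ.+-identityʳ m = refl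
sumTo-+ m (suc n) f rewrite ℕₚ.+-suc m n | sumTo-+ m n f =
  ℤₚ.+-assoc (sumTo m f) (sumTo n (λ j → f (suc (m ℕ.+ j)))) (f (suc (suc (m ℕ.+ n))))

sumTo-point : ∀ n m {f : ℕ → ℤ} → m ≤ n → (∀ k → k ≢ m → f k ≡ 0ℤ) → sumTo n f ≡ f m
sumTo-point zero    .zero z≤n f≗0 = refl
sumTo-point (suc n) m {f} m≤1+n f≗0 with ℕₚ.m≤n⇒m<n∨m≡n m≤1+n
... | inj₁ (s≤s m≤n) =
  trans (cong₂ _+_ (sumTo-point n m m≤n f≗0) (f≗0 (suc n) (ℕₚ.>⇒≢ (s≤s m≤n))))
        (ℤₚ.+-identityʳ (f m))
... | inj₂ refl =
  trans (cong (_+ f (suc n)) (sumTo-zero n (λ k k≤n → f≗0 k (ℕₚ.<⇒≢ (s≤s k≤n)))))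
        (ℤₚ.+-identityˡ (f (suc n)))

sumTo-truncate : ∀ m n {f : ℕ → ℤ} → m ≤ n → (∀ k → m < k → k ≤ n → f k ≡ 0ℤ) →
                 sumTo n f ≡ sumTo m f
sumTo-truncate m zero    z≤n   f≗0 = refl
sumTo-truncate m (suc n) m≤1+n f≗0 with ℕₚ.m≤n⇒m<n∨m≡n m≤1+n
... | inj₁ (s≤s m≤n) =
  trans (cong₂ _+_ (sumTo-truncate m n m≤n (λ k m<k k≤n → f≗0 k m<k (ℕₚ.m≤n⇒m≤1+n k≤n)))
                   (f≗0 (suc n) (s≤s m≤n) ℕₚ.≤-refl))
        (ℤₚ.+-identityʳ _)
... | inj₂ refl = refl

antidiagonal : ℕ → (ℕ → ℕ → ℤ) → ℤ
antidiagonal n h = sumTo n (λ a → h a (n ∸ a))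

antidiagonal-cong : ∀ n {h h′ : ℕ → ℕ → ℤ} → (∀ a b → a ℕ.+ b ≡ n → h a b ≡ h′ a b) →
                    antidiagonal n h ≡ antidiagonal n h′
antidiagonal-cong n h≗h′ = sumTo-cong n (λ a a≤n → h≗h′ a (n ∸ a) (ℕₚ.m+[n∸m]≡n a≤n))

antidiagonal-distrib-+ : ∀ n h h′ →
  antidiagonal n (λ a b → h a b + h′ a b) ≡ antidiagonal n h + antidiagonal n h′
antidiagonal-distrib-+ n h h′ = sumTo-distrib-+ n (λ a → h a (n ∸ a)) (λ a → h′ a (n ∸ a))

antidiagonal-first : ∀ n h → antidiagonal (suc n) h ≡ h 0 (suc n) + antidiagonal n (λ a b → h (suc a) b)
antidiagonal-first n h = sumTo-suc n (λ a → h a (suc n ∸ a))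

antidiagonal-last : ∀ n h → antidiagonal (suc n) h ≡ antidiagonal n (λ a b → h a (suc b)) + h (suc n) 0
antidiagonal-last n h =
  cong₂ _+_ (sumTo-cong n (λ a a≤n → cong (h a) (ℕₚ.+-∸-assoc 1 a≤n))) (cong (h (suc n)) (ℕₚ.n∸n≡0 n))

antidiagonal-swap : ∀ n h → antidiagonal n h ≡ antidiagonal n (λ a b → h b a)
antidiagonal-swap zero    h = refl
antidiagonal-swap (suc n) h = begin
  antidiagonal (suc n) h                              ≡⟨ antidiagonal-first n h ⟩
  h 0 (suc n) + antidiagonal n (λ a b → h (suc a) b)  ≡⟨ cong (h 0 (suc n) +_) (antidiagonal-swap n (λ a b → h (suc a) b)) ⟩
  h 0 (suc n) + antidiagonal n (λ a b → h (suc b) a)  ≡⟨ ℤₚ.+-comm (h 0 (suc n)) (antidiagonal n (λ a b → h (suc b) a)) ⟩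
  antidiagonal n (λ a b → h (suc b) a) + h 0 (suc n)  ≡⟨ antidiagonal-last n (λ a b → h b a) ⟨
  antidiagonal (suc n) (λ a b → h b a)                ∎
  where open ≡-Reasoning

antidiagonal-assoc : ∀ n (F : ℕ → ℕ → ℕ → ℤ) →
  antidiagonal n (λ k l → antidiagonal k (λ i j → F i j l)) ≡
  antidiagonal n (λ i m → antidiagonal m (λ j l → F i j l))
antidiagonal-assoc zero    F = refl
antidiagonal-assoc (suc n) F = begin
  antidiagonal (suc n) (λ k l → antidiagonal k (λ i j → F i j l))
    ≡⟨ antidiagonal-first n (λ k l → antidiagonal k (λ i j → F i j l)) ⟩
  F 0 0 (suc n) + antidiagonal n (λ k l → antidiagonal (suc k) (λ i j → F i j l))
    ≡⟨ cong (F 0 0 (suc n) +_) (sumTo-cong n (λ k _ → antidiagonal-first k (λ i j → F i j (n ∸ k)))) ⟩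
  F 0 0 (suc n) + antidiagonal n (λ k l → F 0 (suc k) l + antidiagonal k (λ i j → F (suc i) j l))
    ≡⟨ cong (F 0 0 (suc n) +_) (antidiagonal-distrib-+ n (λ k l → F 0 (suc k) l) (λ k l → antidiagonal k (λ i j → F (suc i) j l))) ⟩
  F 0 0 (suc n) + (antidiagonal n (λ k l → F 0 (suc k) l) + antidiagonal n (λ k l → antidiagonal k (λ i j → F (suc i) j l)))
    ≡⟨ cong (λ x → F 0 0 (suc n) + (antidiagonal n (λ k l → F 0 (suc k) l) + x)) (antidiagonal-assoc n (λ i → F (suc i))) ⟩
  F 0 0 (suc n) + (antidiagonal n (λ k l → F 0 (suc k) l) + antidiagonal n (λ i m → antidiagonal m (λ j l → F (suc i) j l)))
    ≡⟨ ℤₚ.+-assoc (F 0 0 (suc n)) (antidiagonal n (λ k l → F 0 (suc k) l)) rest ⟨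
  (F 0 0 (suc n) + antidiagonal n (λ k l → F 0 (suc k) l)) + rest
    ≡⟨ cong (_+ rest) (antidiagonal-first n (F 0)) ⟨
  antidiagonal (suc n) (F 0) + rest
    ≡⟨ antidiagonal-first n (λ i m → antidiagonal m (λ j l → F i j l)) ⟨
  antidiagonal (suc n) (λ i m → antidiagonal m (λ j l → F i j l)) ∎
  where
  open ≡-Reasoning
  rest : ℤ
  rest = antidiagonal n (λ i m → antidiagonal m (λ j l → F (suc i) j l))

-- The ring of formal power series

-- A record rather than ∀ n → f n ≡ g n, so that f and g stay inferable.
infix 4 _≐_
record _≐_ (f g : Series) : Set where
  constructor mk≐
  field at : ∀ n → f n ≡ g n
open _≐_ public

0ₛ : Series
0ₛ _ = 0ℤ

-ₛ_ : Series → Series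
(-ₛ f) n = - f n

const : ℤ → Series
const c = mono c 0

≐-refl : ∀ {f} → f ≐ f
≐-refl = mk≐ (λ _ → refl)

≐-sym : ∀ {f g} → f ≐ g → g ≐ f
≐-sym f≐g = mk≐ (λ n → sym (at f≐g n))

≐-trans : ∀ {f g h} → f ≐ g → g ≐ h → f ≐ h
≐-trans f≐g g≐h = mk≐ (λ n → trans (at f≐g n) (at g≐h n))

≐-reflexive : ∀ {f g} → f ≡ g → f ≐ g
≐-reflexive refl = ≐-refl

⊕-cong : ∀ {f f′ g g′} → f ≐ f′ → g ≐ g′ → f ⊕ g ≐ f′ ⊕ g′
⊕-cong f≐f′ g≐g′ = mk≐ (λ n → cong₂ _+_ (at f≐f′ n) (at g≐g′ n))

⊖-cong : ∀ {f f′ g g′} → f ≐ f′ → g ≐ g′ → f ⊖ g ≐ f′ ⊖ g′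
⊖-cong f≐f′ g≐g′ = mk≐ (λ n → cong₂ _-_ (at f≐f′ n) (at g≐g′ n))

-ₛ-cong : ∀ {f f′} → f ≐ f′ → -ₛ f ≐ -ₛ f′
-ₛ-cong f≐f′ = mk≐ (λ n → cong -_ (at f≐f′ n))

⊛-cong : ∀ {f f′ g g′} → f ≐ f′ → g ≐ g′ → f ⊛ g ≐ f′ ⊛ g′
⊛-cong f≐f′ g≐g′ = mk≐ (λ n → sumTo-cong n (λ k _ → cong₂ _*_ (at f≐f′ k) (at g≐g′ (n ∸ k))))

⊛-comm : ∀ f g → f ⊛ g ≐ g ⊛ f
⊛-comm f g = mk≐ (λ n → trans (antidiagonal-swap n (λ a b → f a * g b))
                               (sumTo-cong n (λ k _ → ℤₚ.*-comm (f (n ∸ k)) (g k))))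

⊛-assoc : ∀ f g h → (f ⊛ g) ⊛ h ≐ f ⊛ (g ⊛ h)
⊛-assoc f g h = mk≐ λ n → begin
  antidiagonal n (λ k l → antidiagonal k (λ i j → f i * g j) * h l)
    ≡⟨ sumTo-cong n (λ k _ → sumTo-*ʳ k (h (n ∸ k)) (λ i → f i * g (k ∸ i))) ⟨
  antidiagonal n (λ k l → antidiagonal k (λ i j → f i * g j * h l))
    ≡⟨ antidiagonal-assoc n (λ i j l → f i * g j * h l) ⟩
  antidiagonal n (λ i m → antidiagonal m (λ j l → f i * g j * h l))
    ≡⟨ sumTo-cong n (λ i _ → trans (sumTo-cong (n ∸ i) (λ j _ → ℤₚ.*-assoc (f i) (g j) (h (n ∸ i ∸ j))))
                                   (sumTo-*ˡ (n ∸ i) (f i) (λ j → g j * h (n ∸ i ∸ j)))) ⟩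
  antidiagonal n (λ i m → f i * antidiagonal m (λ j l → g j * h l)) ∎
  where open ≡-Reasoning

⊛-distribˡ : ∀ f g h → f ⊛ (g ⊕ h) ≐ f ⊛ g ⊕ f ⊛ h
⊛-distribˡ f g h = mk≐ λ n →
  trans (sumTo-cong n (λ k _ → ℤₚ.*-distribˡ-+ (f k) (g (n ∸ k)) (h (n ∸ k)))) (sumTo-distrib-+ n _ _)

⊛-distribʳ : ∀ f g h → (g ⊕ h) ⊛ f ≐ g ⊛ f ⊕ h ⊛ f
⊛-distribʳ f g h = mk≐ λ n →
  trans (sumTo-cong n (λ k _ → ℤₚ.*-distribʳ-+ (f (n ∸ k)) (g k) (h k))) (sumTo-distrib-+ n _ _)

const-⊛ : ∀ c f → const c ⊛ f ≐ (λ n → c * f n)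
const-⊛ c f = mk≐ λ n → sumTo-point n 0 z≤n (const-vanishes n)
  where
  const-vanishes : ∀ n k → k ≢ 0 → const c k * f (n ∸ k) ≡ 0ℤ
  const-vanishes n zero    k≢0 = ⊥-elim (k≢0 refl)
  const-vanishes n (suc k) _   = refl

⊛-identityˡ : ∀ f → one ⊛ f ≐ f
⊛-identityˡ f = mk≐ λ n → trans (at (const-⊛ 1ℤ f) n) (ℤₚ.*-identityˡ (f n))

⊛-identityʳ : ∀ f → f ⊛ one ≐ f
⊛-identityʳ f = ≐-trans (⊛-comm f one) (⊛-identityˡ f)

Series-isCommutativeRing : IsCommutativeRing _≐_ _⊕_ _⊛_ -ₛ_ 0ₛ one
Series-isCommutativeRing = record
  { isRing = record
    { +-isAbelianGroup = record
      { isGroup = record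
        { isMonoid = record
          { isSemigroup = record
            { isMagma = record
              { isEquivalence = record { refl = ≐-refl ; sym = ≐-sym ; trans = ≐-trans }
              ; ∙-cong = ⊕-cong }
            ; assoc = λ f g h → mk≐ λ n → ℤₚ.+-assoc (f n) (g n) (h n) }
          ; identity = (λ f → mk≐ λ n → ℤₚ.+-identityˡ (f n)) , (λ f → mk≐ λ n → ℤₚ.+-identityʳ (f n)) }
        ; inverse = (λ f → mk≐ λ n → ℤₚ.+-inverseˡ (f n)) , (λ f → mk≐ λ n → ℤₚ.+-inverseʳ (f n))
        ; ⁻¹-cong = -ₛ-cong }
      ; comm = λ f g → mk≐ λ n → ℤₚ.+-comm (f n) (g n) }
    ; *-cong = ⊛-cong
    ; *-assoc = ⊛-assoc
    ; *-identity = ⊛-identityˡ , ⊛-identityʳ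
    ; distrib = ⊛-distribˡ , ⊛-distribʳ }
  ; *-comm = ⊛-comm }

Series-commutativeRing : CommutativeRing 0ℓ 0ℓ
Series-commutativeRing = record { isCommutativeRing = Series-isCommutativeRing }

module ≐-Reasoning where
  open SetoidReasoning (CommutativeRing.setoid Series-commutativeRing) public
    using (begin_; _∎; _IsRelatedTo_; step-≈-⟩)
  infixr 2 step-≐
  step-≐ : ∀ f {g h} → g IsRelatedTo h → f ≐ g → f IsRelatedTo h
  step-≐ = step-≈-⟩
  syntax step-≐ f g≐h f≐g = f ≐⟨ f≐g ⟩ g≐h

const-morphism : ℤ.+-*-rawRing ACR.-Raw-AlmostCommutative⟶ ACR.fromCommutativeRing Series-commutativeRing
const-morphism = record
  { ⟦_⟧    = const
  ; +-homo = λ a b → mk≐ (λ { zero → refl ; (suc n) → refl })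
  ; *-homo = λ a b → ≐-trans (mk≐ (const-* a b)) (≐-sym (const-⊛ a (const b)))
  ; -‿homo = λ a → mk≐ (λ { zero → refl ; (suc n) → refl })
  ; 0-homo = mk≐ (λ { zero → refl ; (suc n) → refl })
  ; 1-homo = ≐-refl }
  where
  const-* : ∀ a b n → const (a * b) n ≡ a * const b n
  const-* a b zero    = refl
  const-* a b (suc n) = sym (ℤₚ.*-zeroʳ a)

const-≟ : ∀ a b → Maybe (const a ≐ const b)
const-≟ a b with a ℤ.≟ b
... | yes refl = just ≐-refl
... | no _     = nothing

open Algebra.Solver.Ring ℤ.+-*-rawRing (ACR.fromCommutativeRing Series-commutativeRing) const-morphism const-≟
  using (solve; _:=_; _:+_; _:*_; _:-_; con)

-- Monomials, congruences modulo q^(N+1) and divisibility by q^m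

infix 8 q^_
q^_ : ℕ → Series
q^ m = mono 1ℤ m

mono-diagonal : ∀ c m → mono c m m ≡ c
mono-diagonal c zero    = refl
mono-diagonal c (suc m) = mono-diagonal c m

mono-off-diagonal : ∀ c m k → k ≢ m → mono c m k ≡ 0ℤ
mono-off-diagonal c zero    zero    k≢m = ⊥-elim (k≢m refl)
mono-off-diagonal c zero    (suc k) k≢m = refl
mono-off-diagonal c (suc m) zero    k≢m = refl
mono-off-diagonal c (suc m) (suc k) k≢m = mono-off-diagonal c m k (k≢m ∘ cong suc)

mono-⊛-≥ : ∀ c m f n → m ≤ n → (mono c m ⊛ f) n ≡ c * f (n ∸ m)
mono-⊛-≥ c m f n m≤n =
  trans (sumTo-point n m m≤n (λ k k≢m → cong (_* f (n ∸ k)) (mono-off-diagonal c m k k≢m)))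
        (cong (_* f (n ∸ m)) (mono-diagonal c m))

mono-⊛-< : ∀ c m f n → n < m → (mono c m ⊛ f) n ≡ 0ℤ
mono-⊛-< c m f n n<m = sumTo-zero n (λ k k≤n →
  cong (_* f (n ∸ k)) (mono-off-diagonal c m k (ℕₚ.<⇒≢ (ℕₚ.≤-<-trans k≤n n<m))))

mono-⊛-mono : ∀ a b i j → mono a i ⊛ mono b j ≐ mono (a * b) (i ℕ.+ j)
mono-⊛-mono a b i j = mk≐ coefficient
  where
  coefficient : ∀ n → (mono a i ⊛ mono b j) n ≡ mono (a * b) (i ℕ.+ j) n
  coefficient n with i ℕ.≤? n
  ... | no i≰n = trans (mono-⊛-< a i (mono b j) n (ℕₚ.≰⇒> i≰n))
    (sym (mono-off-diagonal (a * b) (i ℕ.+ j) n (λ n≡i+j → i≰n (subst (i ≤_) (sym n≡i+j) (ℕₚ.m≤m+n i j)))))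
  ... | yes i≤n with (n ∸ i) ℕ.≟ j
  ...   | yes refl = begin
    (mono a i ⊛ mono b (n ∸ i)) n          ≡⟨ mono-⊛-≥ a i (mono b (n ∸ i)) n i≤n ⟩
    a * mono b (n ∸ i) (n ∸ i)             ≡⟨ cong (a *_) (mono-diagonal b (n ∸ i)) ⟩
    a * b                                  ≡⟨ mono-diagonal (a * b) n ⟨
    mono (a * b) n n                       ≡⟨ cong (λ m → mono (a * b) m n) (ℕₚ.m+[n∸m]≡n i≤n) ⟨
    mono (a * b) (i ℕ.+ (n ∸ i)) n         ∎
    where open ≡-Reasoning
  ...   | no n∸i≢j = begin
    (mono a i ⊛ mono b j) n                ≡⟨ mono-⊛-≥ a i (mono b j) n i≤n ⟩
    a * mono b j (n ∸ i)                   ≡⟨ cong (a *_) (mono-off-diagonal b j (n ∸ i) n∸i≢j) ⟩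
    a * 0ℤ                                 ≡⟨ ℤₚ.*-zeroʳ a ⟩
    0ℤ                                     ≡⟨ mono-off-diagonal (a * b) (i ℕ.+ j) n
                                                (λ n≡i+j → n∸i≢j (trans (cong (_∸ i) n≡i+j) (ℕₚ.m+n∸m≡n i j))) ⟨
    mono (a * b) (i ℕ.+ j) n               ∎
    where open ≡-Reasoning

q^-+ : ∀ i j → q^ i ⊛ q^ j ≐ q^ (i ℕ.+ j)
q^-+ = mono-⊛-mono 1ℤ 1ℤ

q^-cong : ∀ {i j} → i ≡ j → q^ i ≐ q^ j
q^-cong refl = ≐-refl

infix 4 _≈[_]_
record _≈[_]_ (f : Series) (N : ℕ) (g : Series) : Set where
  constructor mk≈
  field at≈ : ∀ i → i ≤ N → f i ≡ g i
open _≈[_]_ public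

≐⇒≈ : ∀ {f g N} → f ≐ g → f ≈[ N ] g
≐⇒≈ f≐g = mk≈ λ i _ → at f≐g i

≈⇒≐ : ∀ {f g} → (∀ N → f ≈[ N ] g) → f ≐ g
≈⇒≐ f≈g = mk≐ λ N → at≈ (f≈g N) N ℕₚ.≤-refl

≈-refl : ∀ {f N} → f ≈[ N ] f
≈-refl = mk≈ λ _ _ → refl

≈-sym : ∀ {f g N} → f ≈[ N ] g → g ≈[ N ] f
≈-sym f≈g = mk≈ λ i i≤N → sym (at≈ f≈g i i≤N)

≈-trans : ∀ {f g h N} → f ≈[ N ] g → g ≈[ N ] h → f ≈[ N ] h
≈-trans f≈g g≈h = mk≈ λ i i≤N → trans (at≈ f≈g i i≤N) (at≈ g≈h i i≤N)

≈-weaken : ∀ {f g N M} → M ≤ N → f ≈[ N ] g → f ≈[ M ] g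
≈-weaken M≤N f≈g = mk≈ λ i i≤M → at≈ f≈g i (ℕₚ.≤-trans i≤M M≤N)

⊕-cong≈ : ∀ {f f′ g g′ N} → f ≈[ N ] f′ → g ≈[ N ] g′ → f ⊕ g ≈[ N ] f′ ⊕ g′
⊕-cong≈ f≈f′ g≈g′ = mk≈ λ i i≤N → cong₂ _+_ (at≈ f≈f′ i i≤N) (at≈ g≈g′ i i≤N)

⊖-cong≈ : ∀ {f f′ g g′ N} → f ≈[ N ] f′ → g ≈[ N ] g′ → f ⊖ g ≈[ N ] f′ ⊖ g′
⊖-cong≈ f≈f′ g≈g′ = mk≈ λ i i≤N → cong₂ _-_ (at≈ f≈f′ i i≤N) (at≈ g≈g′ i i≤N)

⊛-cong≈ : ∀ {f f′ g g′ N} → f ≈[ N ] f′ → g ≈[ N ] g′ → f ⊛ g ≈[ N ] f′ ⊛ g′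
⊛-cong≈ f≈f′ g≈g′ = mk≈ λ i i≤N → sumTo-cong i (λ k k≤i →
  cong₂ _*_ (at≈ f≈f′ k (ℕₚ.≤-trans k≤i i≤N)) (at≈ g≈g′ (i ∸ k) (ℕₚ.≤-trans (ℕₚ.m∸n≤m i k) i≤N)))

≈-setoid : ℕ → Setoid 0ℓ 0ℓ
≈-setoid N = record
  { Carrier = Series
  ; _≈_ = _≈[ N ]_
  ; isEquivalence = record { refl = ≈-refl ; sym = ≈-sym ; trans = ≈-trans } }

module ≈-Reasoning {N : ℕ} where
  open SetoidReasoning (≈-setoid N) public using (begin_; _∎; _IsRelatedTo_; step-≈-⟩; step-≈-⟨)
  infixr 2 step-≐
  step-≐ : ∀ f {g h} → g IsRelatedTo h → f ≐ g → f IsRelatedTo h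
  step-≐ f g≈h f≐g = step-≈-⟩ f g≈h (≐⇒≈ f≐g)
  syntax step-≐ f g≈h f≐g = f ≐⟨ f≐g ⟩ g≈h

-- A series with constant term 1 is a unit, so it is not a zero divisor modulo q^(N+1).
⊛-cancelˡ-≈ : ∀ {u f g N} → u 0 ≡ 1ℤ → u ⊛ f ≈[ N ] u ⊛ g → f ≈[ N ] g
⊛-cancelˡ-≈ {u} {f} {g} {N} u₀≡1 uf≈ug =
  mk≈ λ i i≤N → ℤₚ.i-j≡0⇒i≡j (f i) (g i) (difference-vanishes i i≤N i ℕₚ.≤-refl)
  where
  d : Series
  d = f ⊖ g
  ud≈0 : u ⊛ d ≈[ N ] 0ₛ
  ud≈0 = ≈-trans (≐⇒≈ (solve 3 (λ u f g → u :* (f :- g) := u :* f :- u :* g) ≐-refl u f g))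
                 (mk≈ λ i i≤N → trans (cong (_- (u ⊛ g) i) (at≈ uf≈ug i i≤N)) (ℤₚ.+-inverseʳ ((u ⊛ g) i)))
  difference-vanishes : ∀ n → n ≤ N → ∀ k → k ≤ n → d k ≡ 0ℤ
  difference-vanishes zero    0≤N .zero z≤n = begin
    d 0               ≡⟨ ℤₚ.*-identityˡ (d 0) ⟨
    1ℤ * d 0          ≡⟨ cong (_* d 0) u₀≡1 ⟨
    u 0 * d 0         ≡⟨ at≈ ud≈0 0 0≤N ⟩
    0ℤ                ∎
    where open ≡-Reasoning
  difference-vanishes (suc n) n<N k k≤1+n with ℕₚ.m≤n⇒m<n∨m≡n k≤1+n
  ... | inj₁ (s≤s k≤n) = difference-vanishes n (ℕₚ.<⇒≤ n<N) k k≤n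
  ... | inj₂ refl = begin
    d (suc n)                                                   ≡⟨ ℤₚ.*-identityˡ (d (suc n)) ⟨
    1ℤ * d (suc n)                                              ≡⟨ cong (_* d (suc n)) u₀≡1 ⟨
    u 0 * d (suc n)                                             ≡⟨ ℤₚ.+-identityʳ _ ⟨
    u 0 * d (suc n) + 0ℤ                                        ≡⟨ cong (u 0 * d (suc n) +_) lower-terms ⟨
    u 0 * d (suc n) + sumTo n (λ k → u (suc k) * d (n ∸ k))     ≡⟨ sumTo-suc n (λ k → u k * d (suc n ∸ k)) ⟨
    (u ⊛ d) (suc n)                                             ≡⟨ at≈ ud≈0 (suc n) n<N ⟩
    0ℤ                                                          ∎
    where
    open ≡-Reasoning
    lower-terms : sumTo n (λ k → u (suc k) * d (n ∸ k)) ≡ 0ℤ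
    lower-terms = sumTo-zero n (λ k _ →
      trans (cong (u (suc k) *_) (difference-vanishes n (ℕₚ.<⇒≤ n<N) (n ∸ k) (ℕₚ.m∸n≤m n k)))
            (ℤₚ.*-zeroʳ (u (suc k))))

⊛-cancelˡ : ∀ {u f g} → u 0 ≡ 1ℤ → u ⊛ f ≐ u ⊛ g → f ≐ g
⊛-cancelˡ {u} u₀≡1 uf≐ug = ≈⇒≐ (λ N → ⊛-cancelˡ-≈ {u} u₀≡1 (≐⇒≈ uf≐ug))

infix 4 q^_∣_
record q^_∣_ (m : ℕ) (f : Series) : Set where
  constructor mk∣
  field vanishes : ∀ i → i < m → f i ≡ 0ℤ
open q^_∣_ public

q^∣mono : ∀ c m → q^ m ∣ mono c m
q^∣mono c m = mk∣ λ i i<m → mono-off-diagonal c m i (ℕₚ.<⇒≢ i<m)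

q^∣-weaken : ∀ {m m′ f} → m′ ≤ m → q^ m ∣ f → q^ m′ ∣ f
q^∣-weaken m′≤m q^m∣f = mk∣ λ i i<m′ → vanishes q^m∣f i (ℕₚ.<-≤-trans i<m′ m′≤m)

q^∣-resp-≐ : ∀ {m f g} → f ≐ g → q^ m ∣ f → q^ m ∣ g
q^∣-resp-≐ f≐g q^m∣f = mk∣ λ i i<m → trans (sym (at f≐g i)) (vanishes q^m∣f i i<m)

q^∣-⊛ˡ : ∀ {m f} g → q^ m ∣ f → q^ m ∣ f ⊛ g
q^∣-⊛ˡ g q^m∣f = mk∣ λ i i<m → sumTo-zero i (λ k k≤i →
  cong (_* g (i ∸ k)) (vanishes q^m∣f k (ℕₚ.≤-<-trans k≤i i<m)))

q^∣-⊛ʳ : ∀ {m g} f → q^ m ∣ g → q^ m ∣ f ⊛ g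
q^∣-⊛ʳ {g = g} f q^m∣g = q^∣-resp-≐ (⊛-comm g f) (q^∣-⊛ˡ f q^m∣g)

q^∣-⊖ : ∀ {m f g} → q^ m ∣ f → q^ m ∣ g → q^ m ∣ f ⊖ g
q^∣-⊖ q^m∣f q^m∣g = mk∣ λ i i<m → cong₂ _-_ (vanishes q^m∣f i i<m) (vanishes q^m∣g i i<m)

q^∣⇒≈0 : ∀ {m f} → q^ suc m ∣ f → f ≈[ m ] 0ₛ
q^∣⇒≈0 q^m∣f = mk≈ λ i i≤m → vanishes q^m∣f i (s≤s i≤m)

≈0⇒q^∣ : ∀ {m f} → f ≈[ m ] 0ₛ → q^ suc m ∣ f
≈0⇒q^∣ f≈0 = mk∣ λ i i<1+m → at≈ f≈0 i (ℕₚ.≤-pred i<1+m)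

q^∣⇒≈ : ∀ {m f g} → q^ suc m ∣ f → q^ suc m ∣ g → f ≈[ m ] g
q^∣⇒≈ q^m∣f q^m∣g = ≈-trans (q^∣⇒≈0 q^m∣f) (≈-sym (q^∣⇒≈0 q^m∣g))

-- Finite and infinite products and sums

finProd-cong : ∀ K {F G} → (∀ j → F j ≐ G j) → finProd K F ≐ finProd K G
finProd-cong zero    F≐G = ≐-refl
finProd-cong (suc K) F≐G = ⊛-cong (finProd-cong K F≐G) (F≐G K)

finProd-+ : ∀ a b F → finProd (a ℕ.+ b) F ≐ finProd a F ⊛ finProd b (λ j → F (a ℕ.+ j))
finProd-+ a zero F rewrite ℕₚ.+-identityʳ a = ≐-sym (⊛-identityʳ (finProd a F))
finProd-+ a (suc b) F rewrite ℕₚ.+-suc a b =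
  ≐-trans (⊛-cong (finProd-+ a b F) (≐-refl {F (a ℕ.+ b)}))
          (⊛-assoc (finProd a F) (finProd b (λ j → F (a ℕ.+ j))) (F (a ℕ.+ b)))

finProd-⊛ : ∀ K F G → finProd K (λ j → F j ⊛ G j) ≐ finProd K F ⊛ finProd K G
finProd-⊛ zero    F G = ≐-sym (⊛-identityˡ one)
finProd-⊛ (suc K) F G = ≐-trans (⊛-cong (finProd-⊛ K F G) (≐-refl {F K ⊛ G K}))
  (solve 4 (λ a b c d → (a :* b) :* (c :* d) := (a :* c) :* (b :* d)) ≐-refl (finProd K F) (finProd K G) (F K) (G K))

finProd-pairs : ∀ K F → finProd (K ℕ.+ K) F ≐ finProd K (λ j → F (j ℕ.+ j) ⊛ F (suc (j ℕ.+ j)))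
finProd-pairs zero    F = ≐-refl
finProd-pairs (suc K) F rewrite ℕₚ.+-suc K K =
  ≐-trans (⊛-assoc (finProd (K ℕ.+ K) F) (F (K ℕ.+ K)) (F (suc (K ℕ.+ K))))
          (⊛-cong (finProd-pairs K F) (≐-refl {F (K ℕ.+ K) ⊛ F (suc (K ℕ.+ K))}))

finProd-≈one : ∀ K {F N} → (∀ j → F j ≈[ N ] one) → finProd K F ≈[ N ] one
finProd-≈one zero    F≈1 = ≈-refl
finProd-≈one (suc K) F≈1 = ≈-trans (⊛-cong≈ (finProd-≈one K F≈1) (F≈1 K)) (≐⇒≈ (⊛-identityˡ one))

-- The condition under which the coefficient of q^N of ∏ F is already that of ∏_{j ≤ N} F j.
Multipliable : (ℕ → Series) → Set
Multipliable F = ∀ j → F j ≈[ j ] one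

prod∞ : (ℕ → Series) → Series
prod∞ F N = finProd (suc N) F N

factor : ℤ → ℕ → Series
factor c e = one ⊖ mono c e

factor-cong : ∀ c {e e′} → e ≡ e′ → factor c e ≐ factor c e′
factor-cong c refl = ≐-refl

factor-≈one : ∀ c {e N} → N < e → factor c e ≈[ N ] one
factor-≈one c {e} N<e = mk≈ λ i i≤N →
  trans (cong (λ x → one i - x) (vanishes (q^∣mono c e) i (ℕₚ.≤-<-trans i≤N N<e))) (ℤₚ.+-identityʳ (one i))

factor-multipliable : ∀ c (e : ℕ → ℕ) → (∀ j → j < e j) → Multipliable (λ j → factor c (e j))
factor-multipliable c e j<e j = factor-≈one c (j<e j)

⊛-multipliable : ∀ {F G} → Multipliable F → Multipliable G → Multipliable (λ j → F j ⊛ G j)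
⊛-multipliable F-mult G-mult j = ≈-trans (⊛-cong≈ (F-mult j) (G-mult j)) (≐⇒≈ (⊛-identityˡ one))

shift-multipliable : ∀ {F} K → Multipliable F → Multipliable (λ j → F (K ℕ.+ j))
shift-multipliable K F-mult j = ≈-weaken (ℕₚ.m≤n+m j K) (F-mult (K ℕ.+ j))

finProd-stable : ∀ {F} → Multipliable F → ∀ N K → N ≤ K → finProd K F ≈[ N ] finProd N F
finProd-stable {F} F-mult N K N≤K with ℕₚ.m≤n⇒m<n∨m≡n N≤K
... | inj₂ refl = ≈-refl
finProd-stable {F} F-mult N (suc K) _ | inj₁ (s≤s N≤K) =
  ≈-trans (⊛-cong≈ (finProd-stable F-mult N K N≤K) (≈-weaken N≤K (F-mult K))) (≐⇒≈ (⊛-identityʳ (finProd N F)))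

prod∞-≈finProd : ∀ {F} → Multipliable F → ∀ N K → N ≤ K → prod∞ F ≈[ N ] finProd K F
prod∞-≈finProd F-mult N K N≤K = mk≈ λ i i≤N →
  trans (at≈ (finProd-stable F-mult i (suc i) (ℕₚ.n≤1+n i)) i ℕₚ.≤-refl)
        (sym (at≈ (finProd-stable F-mult i K (ℕₚ.≤-trans i≤N N≤K)) i ℕₚ.≤-refl))

prod∞-cong : ∀ {F G} → (∀ j → F j ≐ G j) → prod∞ F ≐ prod∞ G
prod∞-cong F≐G = mk≐ λ N → at (finProd-cong (suc N) F≐G) N

prod∞-⊛ : ∀ {F G} → Multipliable F → Multipliable G → prod∞ F ⊛ prod∞ G ≐ prod∞ (λ j → F j ⊛ G j)
prod∞-⊛ {F} {G} F-mult G-mult = ≈⇒≐ λ N →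
  ≈-trans (⊛-cong≈ (prod∞-≈finProd F-mult N N ℕₚ.≤-refl) (prod∞-≈finProd G-mult N N ℕₚ.≤-refl))
  (≈-trans (≐⇒≈ (≐-sym (finProd-⊛ N F G)))
           (≈-sym (prod∞-≈finProd (⊛-multipliable F-mult G-mult) N N ℕₚ.≤-refl)))

prod∞-+ : ∀ {F} K → Multipliable F → prod∞ F ≐ finProd K F ⊛ prod∞ (λ j → F (K ℕ.+ j))
prod∞-+ {F} K F-mult = ≈⇒≐ λ N →
  ≈-trans (prod∞-≈finProd F-mult N (K ℕ.+ N) (ℕₚ.m≤n+m N K))
  (≈-trans (≐⇒≈ (finProd-+ K N F))
           (⊛-cong≈ (≈-refl {finProd K F}) (≈-sym (prod∞-≈finProd (shift-multipliable K F-mult) N N ℕₚ.≤-refl))))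

prod∞-pairs : ∀ {F} → Multipliable F → prod∞ F ≐ prod∞ (λ j → F (j ℕ.+ j) ⊛ F (suc (j ℕ.+ j)))
prod∞-pairs {F} F-mult = ≈⇒≐ λ N →
  ≈-trans (prod∞-≈finProd F-mult N (N ℕ.+ N) (ℕₚ.m≤m+n N N))
  (≈-trans (≐⇒≈ (finProd-pairs N F))
           (≈-sym (prod∞-≈finProd pairs-multipliable N N ℕₚ.≤-refl)))
  where
  pairs-multipliable : Multipliable (λ j → F (j ℕ.+ j) ⊛ F (suc (j ℕ.+ j)))
  pairs-multipliable j = ≈-trans
    (⊛-cong≈ (≈-weaken (ℕₚ.m≤m+n j j) (F-mult (j ℕ.+ j)))
             (≈-weaken (ℕₚ.m≤n⇒m≤1+n (ℕₚ.m≤m+n j j)) (F-mult (suc (j ℕ.+ j)))))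
    (≐⇒≈ (⊛-identityˡ one))

prod∞-≈one : ∀ {F N} → Multipliable F → (∀ j → F j ≈[ N ] one) → prod∞ F ≈[ N ] one
prod∞-≈one {F} {N} F-mult F≈1 = ≈-trans (prod∞-≈finProd F-mult N N ℕₚ.≤-refl) (finProd-≈one N F≈1)

prod∞-constant-term : ∀ {F} → Multipliable F → prod∞ F 0 ≡ 1ℤ
prod∞-constant-term F-mult = at≈ (prod∞-≈one F-mult (λ j → ≈-weaken z≤n (F-mult j))) 0 z≤n

-- The condition under which the coefficient of q^N of Σ F is already that of Σ_{n ≤ N} F n.
Summable : (ℕ → Series) → Set
Summable F = ∀ n → q^ n ∣ F n

sumₛ : ℕ → (ℕ → Series) → Series
sumₛ K F i = sumTo K (λ n → F n i)

sumₛ-⊛ : ∀ K c F → c ⊛ sumₛ K F ≐ sumₛ K (λ n → c ⊛ F n)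
sumₛ-⊛ zero    c F = ≐-refl
sumₛ-⊛ (suc K) c F = ≐-trans (⊛-distribˡ c (sumₛ K F) (F (suc K))) (⊕-cong (sumₛ-⊛ K c F) (≐-refl {c ⊛ F (suc K)}))

infSum-≈sumₛ : ∀ {F} → Summable F → ∀ N K → N ≤ K → infSum F ≈[ N ] sumₛ K F
infSum-≈sumₛ F-sum N K N≤K = mk≈ λ i i≤N →
  sym (sumTo-truncate i K (ℕₚ.≤-trans i≤N N≤K) (λ k i<k _ → vanishes (F-sum k) i i<k))

infSum-cong : ∀ {F G} → (∀ n → F n ≐ G n) → infSum F ≐ infSum G
infSum-cong F≐G = mk≐ λ N → sumTo-cong N (λ n _ → at (F≐G n) N)

infSum-⊖ : ∀ F G → infSum (λ n → F n ⊖ G n) ≐ infSum F ⊖ infSum G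
infSum-⊖ F G = mk≐ λ N →
  trans (sumTo-distrib-+ N (λ n → F n N) (λ n → - G n N)) (cong (infSum F N +_) (sumTo-neg N (λ n → G n N)))

infSum-⊛ : ∀ {F} c → Summable F → c ⊛ infSum F ≐ infSum (λ n → c ⊛ F n)
infSum-⊛ {F} c F-sum = ≈⇒≐ λ N →
  ≈-trans (⊛-cong≈ (≈-refl {c}) (infSum-≈sumₛ F-sum N N ℕₚ.≤-refl))
  (≈-trans (≐⇒≈ (sumₛ-⊛ N c F))
           (≈-sym (infSum-≈sumₛ (λ n → q^∣-⊛ʳ c (F-sum n)) N N ℕₚ.≤-refl)))

infSum-suc : ∀ {F} → Summable F → infSum F ≐ F 0 ⊕ infSum (F ∘ suc)
infSum-suc {F} F-sum = ≈⇒≐ λ N →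
  ≈-trans (infSum-≈sumₛ F-sum N (suc N) (ℕₚ.n≤1+n N))
  (≈-trans {g = F 0 ⊕ sumₛ N (F ∘ suc)} (mk≈ λ i _ → sumTo-suc N (λ n → F n i))
           (⊕-cong≈ (≈-refl {F 0}) (≈-sym (infSum-≈sumₛ tail-summable N N ℕₚ.≤-refl))))
  where
  tail-summable : Summable (F ∘ suc)
  tail-summable n = q^∣-weaken (ℕₚ.n≤1+n n) (F-sum (suc n))

q^∣-infSum : ∀ {m F} → (∀ n → q^ m ∣ F n) → q^ m ∣ infSum F
q^∣-infSum q^m∣F = mk∣ λ i i<m → sumTo-zero i (λ n _ → vanishes (q^m∣F n) i i<m)

-- q-Pochhammer symbols

double : ℕ → ℕ
double n = n ℕ.+ n

negPoch∞ poch∞ : ℕ → Series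
negPoch∞ m = pochInf -1ℤ m
poch∞ m = pochInf 1ℤ m

evenPoch∞ oddPoch∞ : ℕ → Series
evenPoch∞ k = prod∞ (λ j → factor 1ℤ (double (suc k ℕ.+ j)))
oddPoch∞ k = prod∞ (λ j → factor 1ℤ (suc (double (k ℕ.+ j))))

negPoch poch evenPoch oddPoch : ℕ → Series
negPoch n = pochFin -1ℤ 1 n
poch n = pochFin 1ℤ 1 n
evenPoch n = finProd n (λ j → factor 1ℤ (double (suc j)))
oddPoch n = finProd n (λ j → factor 1ℤ (suc (double j)))

pochInf-multipliable : ∀ c m → Multipliable (λ j → factor c (suc m ℕ.+ j))
pochInf-multipliable c m = factor-multipliable c (λ j → suc m ℕ.+ j) (λ j → s≤s (ℕₚ.m≤n+m j m))

evenPoch∞-multipliable : ∀ k → Multipliable (λ j → factor 1ℤ (double (suc k ℕ.+ j)))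
evenPoch∞-multipliable k = factor-multipliable 1ℤ (λ j → double (suc k ℕ.+ j))
  (λ j → ℕₚ.≤-trans (s≤s (ℕₚ.m≤n+m j k)) (ℕₚ.m≤m+n (suc k ℕ.+ j) (suc k ℕ.+ j)))

oddPoch∞-multipliable : ∀ k → Multipliable (λ j → factor 1ℤ (suc (double (k ℕ.+ j))))
oddPoch∞-multipliable k = factor-multipliable 1ℤ (λ j → suc (double (k ℕ.+ j)))
  (λ j → s≤s (ℕₚ.≤-trans (ℕₚ.m≤n+m j k) (ℕₚ.m≤m+n (k ℕ.+ j) (k ℕ.+ j))))

factor-neg : ∀ e → factor -1ℤ e ≐ one ⊕ q^ e
factor-neg e = mk≐ λ n → coefficient (e ℕ.≡ᵇ n) (one n)
  where
  coefficient : ∀ b x → x - (if b then -1ℤ else 0ℤ) ≡ x + (if b then 1ℤ else 0ℤ)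
  coefficient true  x = refl
  coefficient false x = refl

factor-neg-⊛-factor : ∀ e → factor -1ℤ e ⊛ factor 1ℤ e ≐ factor 1ℤ (double e)
factor-neg-⊛-factor e = begin
  factor -1ℤ e ⊛ factor 1ℤ e   ≐⟨ ⊛-cong (factor-neg e) (≐-refl {factor 1ℤ e}) ⟩
  (one ⊕ q^ e) ⊛ (one ⊖ q^ e)  ≐⟨ solve 1 (λ x → (con 1ℤ :+ x) :* (con 1ℤ :- x) := con 1ℤ :- x :* x) ≐-refl (q^ e) ⟩
  one ⊖ q^ e ⊛ q^ e            ≐⟨ ⊖-cong (≐-refl {one}) (q^-+ e e) ⟩
  factor 1ℤ (double e)         ∎
  where open ≐-Reasoning

evenPoch∞-step : ∀ k → evenPoch∞ k ≐ factor 1ℤ (double (suc k)) ⊛ evenPoch∞ (suc k)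
evenPoch∞-step k = ≐-trans (prod∞-+ 1 (evenPoch∞-multipliable k))
  (⊛-cong (≐-trans (⊛-identityˡ _) (factor-cong 1ℤ (cong double (ℕₚ.+-identityʳ (suc k)))))
          (prod∞-cong (λ j → factor-cong 1ℤ (cong double (ℕₚ.+-suc (suc k) j)))))

oddPoch∞-step : ∀ k → oddPoch∞ k ≐ factor 1ℤ (suc (double k)) ⊛ oddPoch∞ (suc k)
oddPoch∞-step k = ≐-trans (prod∞-+ 1 (oddPoch∞-multipliable k))
  (⊛-cong (≐-trans (⊛-identityˡ _) (factor-cong 1ℤ (cong (suc ∘ double) (ℕₚ.+-identityʳ k))))
          (prod∞-cong (λ j → factor-cong 1ℤ (cong (suc ∘ double) (ℕₚ.+-suc k j)))))

negPoch∞-⊛-poch∞ : ∀ n → negPoch∞ (suc n) ⊛ poch∞ (suc n) ≐ evenPoch∞ n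
negPoch∞-⊛-poch∞ n = ≐-trans (prod∞-⊛ (pochInf-multipliable -1ℤ n) (pochInf-multipliable 1ℤ n))
                             (prod∞-cong (λ j → factor-neg-⊛-factor (suc n ℕ.+ j)))

negPoch∞-⊛-negPoch : ∀ n → negPoch∞ (suc n) ⊛ negPoch n ≐ negPoch∞ 1
negPoch∞-⊛-negPoch n = ≐-trans (⊛-comm (negPoch∞ (suc n)) (negPoch n))
                               (≐-sym (prod∞-+ n (pochInf-multipliable -1ℤ 0)))

poch-constant-term : ∀ n → poch n 0 ≡ 1ℤ
poch-constant-term n = at≈ (finProd-≈one n (λ j → factor-≈one 1ℤ (s≤s z≤n))) 0 z≤n

poch-⊛-negPoch : ∀ n → poch n ⊛ negPoch n ≐ evenPoch n
poch-⊛-negPoch n = ≐-trans (≐-sym (finProd-⊛ n (λ j → factor 1ℤ (suc j)) (λ j → factor -1ℤ (suc j))))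
  (finProd-cong n (λ j → ≐-trans (⊛-comm (factor 1ℤ (suc j)) (factor -1ℤ (suc j))) (factor-neg-⊛-factor (suc j))))

-- (q^(n+1);q)ₙ = (q;q)₂ₙ / (q;q)ₙ, and (q;q)₂ₙ = (q;q²)ₙ (q²;q²)ₙ = (q;q²)ₙ (q;q)ₙ (-q;q)ₙ.
pochFin-split : ∀ n → pochFin 1ℤ (suc n) n ≐ oddPoch n ⊛ negPoch n
pochFin-split n = ⊛-cancelˡ {poch n} (poch-constant-term n) (begin
  poch n ⊛ pochFin 1ℤ (suc n) n  ≐⟨ ≐-sym (finProd-+ n n (λ j → factor 1ℤ (suc j))) ⟩
  poch (n ℕ.+ n)                 ≐⟨ finProd-pairs n (λ j → factor 1ℤ (suc j)) ⟩
  finProd n (λ j → factor 1ℤ (suc (double j)) ⊛ factor 1ℤ (suc (suc (double j))))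
    ≐⟨ ≐-trans (finProd-⊛ n (λ j → factor 1ℤ (suc (double j))) (λ j → factor 1ℤ (suc (suc (double j)))))
               (⊛-cong (≐-refl {oddPoch n}) (finProd-cong n (λ j → factor-cong 1ℤ (cong suc (sym (ℕₚ.+-suc j j)))))) ⟩
  oddPoch n ⊛ evenPoch n         ≐⟨ ⊛-cong (≐-refl {oddPoch n}) (≐-sym (poch-⊛-negPoch n)) ⟩
  oddPoch n ⊛ (poch n ⊛ negPoch n)
    ≐⟨ solve 3 (λ o p g → o :* (p :* g) := p :* (o :* g)) ≐-refl (oddPoch n) (poch n) (negPoch n) ⟩
  poch n ⊛ (oddPoch n ⊛ negPoch n) ∎)
  where open ≐-Reasoning

-- The sum Σₙ qⁿ (q;q²)ₙ (q^(2n+2);q²)∞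

summand : ℕ → ℕ → Series
summand k n = q^ (n ℕ.* suc (double k)) ⊛ oddPoch n ⊛ evenPoch∞ n

A : ℕ → Series
A k = infSum (summand k)

summand-summable : ∀ k → Summable (summand k)
summand-summable k n = q^∣-⊛ˡ (evenPoch∞ n) (q^∣-⊛ˡ (oddPoch n)
  (q^∣-weaken (ℕₚ.m≤m*n n (suc (double k))) (q^∣mono 1ℤ (n ℕ.* suc (double k)))))

summand-zero : ∀ k → summand k 0 ≐ evenPoch∞ 0
summand-zero k = ≐-trans (⊛-cong (⊛-identityˡ one) (≐-refl {evenPoch∞ 0})) (⊛-identityˡ (evenPoch∞ 0))

-- Stated with k + k for double k, which the ring solver cannot unfold.
summand-exponent-suc : ∀ k n → suc n ℕ.* suc (suc k ℕ.+ suc k) ≡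
                               suc (k ℕ.+ k) ℕ.+ n ℕ.* suc (k ℕ.+ k) ℕ.+ (suc n ℕ.+ suc n)
summand-exponent-suc = solve-∀

summand-exponent-q : ∀ k n → 1 ℕ.+ n ℕ.* suc (suc k ℕ.+ suc k) ≡ n ℕ.* suc (k ℕ.+ k) ℕ.+ suc (n ℕ.+ n)
summand-exponent-q = solve-∀

summand-step : ∀ k n → summand k (suc n) ⊖ summand (suc k) (suc n) ≐
                       q^ suc (double k) ⊛ (summand k n ⊖ q^ 1 ⊛ summand (suc k) n)
summand-step k n = begin
  summand k (suc n) ⊖ summand (suc k) (suc n)
    ≐⟨ ⊖-cong (⊛-cong (⊛-cong (≐-sym (q^-+ z (n ℕ.* z))) (≐-refl {O ⊛ (one ⊖ U)})) (≐-refl {R}))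
              (⊛-cong (⊛-cong exponent-suc-suc (≐-refl {O ⊛ (one ⊖ U)})) (≐-refl {R})) ⟩
  Z ⊛ W ⊛ (O ⊛ (one ⊖ U)) ⊛ R ⊖ Z ⊛ W ⊛ V ⊛ (O ⊛ (one ⊖ U)) ⊛ R
    ≐⟨ solve 6 (λ z w v u o r → z :* w :* (o :* (con 1ℤ :- u)) :* r :- z :* w :* v :* (o :* (con 1ℤ :- u)) :* r
                             := z :* (w :* o :* ((con 1ℤ :- v) :* r) :- w :* u :* o :* ((con 1ℤ :- v) :* r)))
               ≐-refl Z W V U O R ⟩
  Z ⊛ (W ⊛ O ⊛ ((one ⊖ V) ⊛ R) ⊖ W ⊛ U ⊛ O ⊛ ((one ⊖ V) ⊛ R))
    ≐⟨ ⊛-cong (≐-refl {Z}) (⊖-cong (⊛-cong (≐-refl {W ⊛ O}) (≐-sym (evenPoch∞-step n))) (≐-sym q-summand)) ⟩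
  Z ⊛ (summand k n ⊖ q^ 1 ⊛ summand (suc k) n) ∎
  where
  open ≐-Reasoning
  z z′ : ℕ
  z = suc (double k)
  z′ = suc (double (suc k))
  Z W U V O R : Series
  Z = q^ z
  W = q^ (n ℕ.* z)
  U = q^ suc (double n)
  V = q^ double (suc n)
  O = oddPoch n
  R = evenPoch∞ (suc n)

  exponent-suc-suc : q^ (suc n ℕ.* z′) ≐ Z ⊛ W ⊛ V
  exponent-suc-suc = begin
    q^ (suc n ℕ.* z′)                       ≐⟨ q^-cong (summand-exponent-suc k n) ⟩
    q^ (z ℕ.+ n ℕ.* z ℕ.+ double (suc n))   ≐⟨ ≐-sym (q^-+ (z ℕ.+ n ℕ.* z) (double (suc n))) ⟩
    q^ (z ℕ.+ n ℕ.* z) ⊛ V                  ≐⟨ ⊛-cong (≐-sym (q^-+ z (n ℕ.* z))) (≐-refl {V}) ⟩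
    Z ⊛ W ⊛ V                               ∎

  q-summand : q^ 1 ⊛ summand (suc k) n ≐ W ⊛ U ⊛ O ⊛ ((one ⊖ V) ⊛ R)
  q-summand = begin
    q^ 1 ⊛ (q^ (n ℕ.* z′) ⊛ O ⊛ evenPoch∞ n)
      ≐⟨ solve 4 (λ x y o r → x :* (y :* o :* r) := (x :* y) :* o :* r) ≐-refl (q^ 1) (q^ (n ℕ.* z′)) O (evenPoch∞ n) ⟩
    q^ 1 ⊛ q^ (n ℕ.* z′) ⊛ O ⊛ evenPoch∞ n
      ≐⟨ ⊛-cong (⊛-cong exponent (≐-refl {O})) (evenPoch∞-step n) ⟩
    W ⊛ U ⊛ O ⊛ ((one ⊖ V) ⊛ R) ∎
    where
    exponent : q^ 1 ⊛ q^ (n ℕ.* z′) ≐ W ⊛ U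
    exponent = begin
      q^ 1 ⊛ q^ (n ℕ.* z′)               ≐⟨ q^-+ 1 (n ℕ.* z′) ⟩
      q^ (1 ℕ.+ n ℕ.* z′)                ≐⟨ q^-cong (summand-exponent-q k n) ⟩
      q^ (n ℕ.* z ℕ.+ suc (double n))    ≐⟨ ≐-sym (q^-+ (n ℕ.* z) (suc (double n))) ⟩
      W ⊛ U                              ∎

A-difference : ∀ k → A k ⊖ A (suc k) ≐ q^ suc (double k) ⊛ (A k ⊖ q^ 1 ⊛ A (suc k))
A-difference k = begin
  A k ⊖ A (suc k)
    ≐⟨ ≐-sym (infSum-⊖ (summand k) (summand (suc k))) ⟩
  infSum (λ n → summand k n ⊖ summand (suc k) n)
    ≐⟨ infSum-suc (λ n → q^∣-⊖ (summand-summable k n) (summand-summable (suc k) n)) ⟩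
  (summand k 0 ⊖ summand (suc k) 0) ⊕ infSum (λ n → summand k (suc n) ⊖ summand (suc k) (suc n))
    ≐⟨ ⊕-cong (mk≐ λ i → ℤₚ.+-inverseʳ (summand k 0 i)) (infSum-cong (summand-step k)) ⟩
  0ₛ ⊕ infSum (λ n → Z ⊛ (summand k n ⊖ q^ 1 ⊛ summand (suc k) n))
    ≐⟨ mk≐ (λ i → ℤₚ.+-identityˡ _) ⟩
  infSum (λ n → Z ⊛ (summand k n ⊖ q^ 1 ⊛ summand (suc k) n))
    ≐⟨ ≐-sym (infSum-⊛ Z (λ n → q^∣-⊖ (summand-summable k n) (q^∣-⊛ʳ (q^ 1) (summand-summable (suc k) n)))) ⟩
  Z ⊛ infSum (λ n → summand k n ⊖ q^ 1 ⊛ summand (suc k) n)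
    ≐⟨ ⊛-cong (≐-refl {Z}) (infSum-⊖ (summand k) (λ n → q^ 1 ⊛ summand (suc k) n)) ⟩
  Z ⊛ (A k ⊖ infSum (λ n → q^ 1 ⊛ summand (suc k) n))
    ≐⟨ ⊛-cong (≐-refl {Z}) (⊖-cong (≐-refl {A k}) (≐-sym (infSum-⊛ (q^ 1) (summand-summable (suc k))))) ⟩
  Z ⊛ (A k ⊖ q^ 1 ⊛ A (suc k)) ∎
  where
  open ≐-Reasoning
  Z : Series
  Z = q^ suc (double k)

A-step : ∀ k → factor 1ℤ (suc (double k)) ⊛ A k ≐ factor 1ℤ (double (suc k)) ⊛ A (suc k)
A-step k = begin
  (one ⊖ Z) ⊛ A k
    ≐⟨ solve 4 (λ z q x y → (con 1ℤ :- z) :* x := (x :- y) :- z :* (x :- q :* y) :+ (con 1ℤ :- z :* q) :* y)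
               ≐-refl Z (q^ 1) (A k) (A (suc k)) ⟩
  (A k ⊖ A (suc k)) ⊖ Z ⊛ (A k ⊖ q^ 1 ⊛ A (suc k)) ⊕ (one ⊖ Z ⊛ q^ 1) ⊛ A (suc k)
    ≐⟨ ⊕-cong (⊖-cong (A-difference k) (≐-refl {Z ⊛ (A k ⊖ q^ 1 ⊛ A (suc k))}))
              (⊛-cong (⊖-cong (≐-refl {one}) Zq≐q^double) (≐-refl {A (suc k)})) ⟩
  Z ⊛ (A k ⊖ q^ 1 ⊛ A (suc k)) ⊖ Z ⊛ (A k ⊖ q^ 1 ⊛ A (suc k)) ⊕ (one ⊖ q^ double (suc k)) ⊛ A (suc k)
    ≐⟨ solve 2 (λ x y → x :- x :+ y := y) ≐-refl (Z ⊛ (A k ⊖ q^ 1 ⊛ A (suc k))) ((one ⊖ q^ double (suc k)) ⊛ A (suc k)) ⟩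
  (one ⊖ q^ double (suc k)) ⊛ A (suc k) ∎
  where
  open ≐-Reasoning
  Z : Series
  Z = q^ suc (double k)
  Zq≐q^double : Z ⊛ q^ 1 ≐ q^ double (suc k)
  Zq≐q^double = ≐-trans (q^-+ (suc (double k)) 1)
    (q^-cong (trans (ℕₚ.+-comm (suc (double k)) 1) (cong suc (sym (ℕₚ.+-suc k k)))))

vanishes-by-descent : ∀ (X U : ℕ → Series) → (∀ k → X k ≐ U k ⊛ X (suc k)) → (∀ k → q^ suc k ∣ X k) → X 0 ≐ 0ₛ
vanishes-by-descent X U X-step q^∣X = mk≐ λ N → vanishes (descend N (q^∣X N)) N ℕₚ.≤-refl
  where
  descend : ∀ {m} k → q^ m ∣ X k → q^ m ∣ X 0
  descend zero    q^m∣X = q^m∣X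
  descend (suc k) q^m∣X = descend k (q^∣-resp-≐ (≐-sym (X-step k)) (q^∣-⊛ʳ (U k) q^m∣X))

D : ℕ → Series
D k = oddPoch∞ k ⊛ A k ⊖ evenPoch∞ 0 ⊛ evenPoch∞ k

D-step : ∀ k → D k ≐ factor 1ℤ (double (suc k)) ⊛ D (suc k)
D-step k = begin
  oddPoch∞ k ⊛ A k ⊖ evenPoch∞ 0 ⊛ evenPoch∞ k
    ≐⟨ ⊖-cong (⊛-cong (oddPoch∞-step k) (≐-refl {A k})) (⊛-cong (≐-refl {evenPoch∞ 0}) (evenPoch∞-step k)) ⟩
  F ⊛ oddPoch∞ (suc k) ⊛ A k ⊖ evenPoch∞ 0 ⊛ (G ⊛ evenPoch∞ (suc k))
    ≐⟨ solve 6 (λ f o a q g r → f :* o :* a :- q :* (g :* r) := o :* (f :* a) :- q :* g :* r) ≐-refl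
               F (oddPoch∞ (suc k)) (A k) (evenPoch∞ 0) G (evenPoch∞ (suc k)) ⟩
  oddPoch∞ (suc k) ⊛ (F ⊛ A k) ⊖ evenPoch∞ 0 ⊛ G ⊛ evenPoch∞ (suc k)
    ≐⟨ ⊖-cong (⊛-cong (≐-refl {oddPoch∞ (suc k)}) (A-step k)) (≐-refl {evenPoch∞ 0 ⊛ G ⊛ evenPoch∞ (suc k)}) ⟩
  oddPoch∞ (suc k) ⊛ (G ⊛ A (suc k)) ⊖ evenPoch∞ 0 ⊛ G ⊛ evenPoch∞ (suc k)
    ≐⟨ solve 5 (λ o g a q r → o :* (g :* a) :- q :* g :* r := g :* (o :* a :- q :* r)) ≐-refl
               (oddPoch∞ (suc k)) G (A (suc k)) (evenPoch∞ 0) (evenPoch∞ (suc k)) ⟩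
  G ⊛ D (suc k) ∎
  where
  open ≐-Reasoning
  F G : Series
  F = factor 1ℤ (suc (double k))
  G = factor 1ℤ (double (suc k))

q^∣D : ∀ k → q^ suc k ∣ D k
q^∣D k = ≈0⇒q^∣ (≈-trans (⊖-cong≈ (⊛-cong≈ oddPoch∞≈1 A≈evenPoch∞) (⊛-cong≈ (≈-refl {evenPoch∞ 0}) evenPoch∞≈1))
                        (≐⇒≈ (≐-trans (solve 1 (λ e → con 1ℤ :* (con 1ℤ :* e) :- e :* con 1ℤ := con 0ℤ) ≐-refl (evenPoch∞ 0))
                                      (mk≐ λ { zero → refl ; (suc n) → refl }))))
  where
  oddPoch∞≈1 : oddPoch∞ k ≈[ k ] one
  oddPoch∞≈1 = prod∞-≈one (oddPoch∞-multipliable k)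
    (λ j → factor-≈one 1ℤ (s≤s (ℕₚ.≤-trans (ℕₚ.m≤m+n k j) (ℕₚ.m≤m+n (k ℕ.+ j) (k ℕ.+ j)))))
  evenPoch∞≈1 : evenPoch∞ k ≈[ k ] one
  evenPoch∞≈1 = prod∞-≈one (evenPoch∞-multipliable k)
    (λ j → factor-≈one 1ℤ (ℕₚ.≤-trans (s≤s (ℕₚ.m≤m+n k j)) (ℕₚ.m≤m+n (suc k ℕ.+ j) (suc k ℕ.+ j))))
  q^∣summand-suc : ∀ n → q^ suc k ∣ summand k (suc n)
  q^∣summand-suc n = q^∣-⊛ˡ (evenPoch∞ (suc n)) (q^∣-⊛ˡ (oddPoch (suc n)) (q^∣-weaken
    (ℕₚ.≤-trans (s≤s (ℕₚ.m≤m+n k k)) (ℕₚ.m≤m+n (suc (double k)) (n ℕ.* suc (double k))))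
    (q^∣mono 1ℤ (suc n ℕ.* suc (double k)))))
  A≈evenPoch∞ : A k ≈[ k ] one ⊛ evenPoch∞ 0
  A≈evenPoch∞ = ≈-trans (≐⇒≈ (infSum-suc (summand-summable k)))
    (≈-trans (⊕-cong≈ (≐⇒≈ (summand-zero k)) (q^∣⇒≈0 (q^∣-infSum q^∣summand-suc)))
             (≐⇒≈ (≐-trans (mk≐ λ n → ℤₚ.+-identityʳ (evenPoch∞ 0 n)) (≐-sym (⊛-identityˡ (evenPoch∞ 0))))))

oddPoch∞-⊛-A : oddPoch∞ 0 ⊛ A 0 ≐ evenPoch∞ 0 ⊛ evenPoch∞ 0
oddPoch∞-⊛-A = mk≐ λ n → ℤₚ.i-j≡0⇒i≡j _ _ (at (vanishes-by-descent D (λ k → factor 1ℤ (double (suc k))) D-step q^∣D) n)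

euler-identity : negPoch∞ 1 ⊛ oddPoch∞ 0 ≐ one
euler-identity = ⊛-cancelˡ {evenPoch∞ 0} (prod∞-constant-term (evenPoch∞-multipliable 0)) (begin
  evenPoch∞ 0 ⊛ (negPoch∞ 1 ⊛ oddPoch∞ 0)   ≐⟨ solve 3 (λ e n o → e :* (n :* o) := n :* (o :* e)) ≐-refl (evenPoch∞ 0) (negPoch∞ 1) (oddPoch∞ 0) ⟩
  negPoch∞ 1 ⊛ (oddPoch∞ 0 ⊛ evenPoch∞ 0)   ≐⟨ ⊛-cong (≐-refl {negPoch∞ 1}) (≐-sym poch∞-odd-even) ⟩
  negPoch∞ 1 ⊛ poch∞ 1                      ≐⟨ negPoch∞-⊛-poch∞ 0 ⟩
  evenPoch∞ 0                               ≐⟨ ≐-sym (⊛-identityʳ (evenPoch∞ 0)) ⟩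
  evenPoch∞ 0 ⊛ one                         ∎)
  where
  open ≐-Reasoning
  poch∞-odd-even : poch∞ 1 ≐ oddPoch∞ 0 ⊛ evenPoch∞ 0
  poch∞-odd-even = begin
    poch∞ 1
      ≐⟨ prod∞-pairs (pochInf-multipliable 1ℤ 0) ⟩
    prod∞ (λ j → factor 1ℤ (suc (double j)) ⊛ factor 1ℤ (suc (suc (double j))))
      ≐⟨ prod∞-cong (λ j → ⊛-cong (≐-refl {factor 1ℤ (suc (double j))}) (factor-cong 1ℤ (cong suc (sym (ℕₚ.+-suc j j))))) ⟩
    prod∞ (λ j → factor 1ℤ (suc (double j)) ⊛ factor 1ℤ (double (suc j)))
      ≐⟨ ≐-sym (prod∞-⊛ (oddPoch∞-multipliable 0) (evenPoch∞-multipliable 0)) ⟩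
    oddPoch∞ 0 ⊛ evenPoch∞ 0 ∎

lhsTerm-factor : ∀ n → lhsTerm n ≐ negPoch∞ 1 ⊛ summand 0 n
lhsTerm-factor n = begin
  q^ n ⊛ E ⊛ E ⊛ P ⊛ pochFin 1ℤ (suc n) n
    ≐⟨ ⊛-cong (≐-refl {q^ n ⊛ E ⊛ E ⊛ P}) (pochFin-split n) ⟩
  q^ n ⊛ E ⊛ E ⊛ P ⊛ (oddPoch n ⊛ negPoch n)
    ≐⟨ solve 5 (λ x e p o g → x :* e :* e :* p :* (o :* g) := (e :* g) :* (x :* o :* (e :* p))) ≐-refl
               (q^ n) E P (oddPoch n) (negPoch n) ⟩
  (E ⊛ negPoch n) ⊛ (q^ n ⊛ oddPoch n ⊛ (E ⊛ P))
    ≐⟨ ⊛-cong (negPoch∞-⊛-negPoch n)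
              (⊛-cong (⊛-cong (q^-cong (sym (ℕₚ.*-identityʳ n))) (≐-refl {oddPoch n})) (negPoch∞-⊛-poch∞ n)) ⟩
  negPoch∞ 1 ⊛ summand 0 n ∎
  where
  open ≐-Reasoning
  E P : Series
  E = negPoch∞ (suc n)
  P = poch∞ (suc n)

gaussProduct : Series
gaussProduct = negPoch∞ 1 ⊛ evenPoch∞ 0

B′-product : B′ ≐ gaussProduct ⊛ gaussProduct ⊖ gaussProduct
B′-product = begin
  B′                                       ≐⟨ infSum-cong (λ n → lhsTerm-factor (suc n)) ⟩
  infSum (λ n → E ⊛ summand 0 (suc n))     ≐⟨ ≐-sym (infSum-⊛ E (λ n → q^∣-weaken (ℕₚ.n≤1+n n) (summand-summable 0 (suc n)))) ⟩
  E ⊛ infSum (summand 0 ∘ suc)             ≐⟨ ⊛-cong (≐-refl {E}) tail ⟩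
  E ⊛ (A 0 ⊖ Q)                            ≐⟨ ⊛-cong (≐-refl {E}) (⊖-cong A0 (≐-refl {Q})) ⟩
  E ⊛ (E ⊛ (Q ⊛ Q) ⊖ Q)                    ≐⟨ solve 2 (λ e q → e :* (e :* (q :* q) :- q) := (e :* q) :* (e :* q) :- e :* q) ≐-refl E Q ⟩
  gaussProduct ⊛ gaussProduct ⊖ gaussProduct ∎
  where
  open ≐-Reasoning
  E Q : Series
  E = negPoch∞ 1
  Q = evenPoch∞ 0
  tail : infSum (summand 0 ∘ suc) ≐ A 0 ⊖ Q
  tail = begin
    infSum (summand 0 ∘ suc)          ≐⟨ solve 2 (λ s q → s := (q :+ s) :- q) ≐-refl (infSum (summand 0 ∘ suc)) Q ⟩
    Q ⊕ infSum (summand 0 ∘ suc) ⊖ Q  ≐⟨ ⊖-cong (≐-sym (≐-trans (infSum-suc (summand-summable 0))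
                                                                 (⊕-cong (summand-zero 0) (≐-refl {infSum (summand 0 ∘ suc)}))))
                                                (≐-refl {Q}) ⟩
    A 0 ⊖ Q                           ∎
  A0 : A 0 ≐ E ⊛ (Q ⊛ Q)
  A0 = begin
    A 0                               ≐⟨ ≐-sym (⊛-identityˡ (A 0)) ⟩
    one ⊛ A 0                         ≐⟨ ⊛-cong (≐-sym euler-identity) (≐-refl {A 0}) ⟩
    E ⊛ oddPoch∞ 0 ⊛ A 0              ≐⟨ ⊛-assoc E (oddPoch∞ 0) (A 0) ⟩
    E ⊛ (oddPoch∞ 0 ⊛ A 0)            ≐⟨ ⊛-cong (≐-refl {E}) oddPoch∞-⊛-A ⟩
    E ⊛ (Q ⊛ Q)                       ∎

-- Triangular numbers

triangle : ℕ → ℕ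
triangle zero    = 0
triangle (suc n) = triangle n ℕ.+ suc n

triangle-double : ∀ n → triangle n ℕ.+ triangle n ≡ n ℕ.* suc n
triangle-double zero    = refl
triangle-double (suc n) = begin
  (triangle n ℕ.+ suc n) ℕ.+ (triangle n ℕ.+ suc n)  ≡⟨ regroup (triangle n) n ⟩
  (triangle n ℕ.+ triangle n) ℕ.+ (suc n ℕ.+ suc n)  ≡⟨ cong (ℕ._+ (suc n ℕ.+ suc n)) (triangle-double n) ⟩
  n ℕ.* suc n ℕ.+ (suc n ℕ.+ suc n)                  ≡⟨ factorise n ⟩
  suc n ℕ.* suc (suc n)                              ∎
  where
  open ≡-Reasoning
  regroup : ∀ t n → (t ℕ.+ suc n) ℕ.+ (t ℕ.+ suc n) ≡ (t ℕ.+ t) ℕ.+ (suc n ℕ.+ suc n)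
  regroup = solve-∀
  factorise : ∀ n → n ℕ.* suc n ℕ.+ (suc n ℕ.+ suc n) ≡ suc n ℕ.* suc (suc n)
  factorise = solve-∀

⌊n[n+1]/2⌋≡triangle : ∀ n → ⌊ n ℕ.* suc n /2⌋ ≡ triangle n
⌊n[n+1]/2⌋≡triangle n = trans (cong ⌊_/2⌋ (sym (triangle-double n))) (sym (ℕₚ.n≡⌊n+n/2⌋ (triangle n)))

n≤triangle : ∀ n → n ≤ triangle n
n≤triangle zero    = z≤n
n≤triangle (suc n) = ℕₚ.m≤n+m (suc n) (triangle n)

-- τ m a is t(a - m) for the triangular function t(x) = x(x+1)/2 on ℤ (note t(-x) = t(x - 1)).
τ : ℕ → ℕ → ℕ
τ zero    a       = triangle a
τ (suc m) zero    = triangle m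
τ (suc m) (suc a) = τ m a

τ-zero : ∀ m → τ m 0 ≡ triangle (ℕ.pred m)
τ-zero zero    = refl
τ-zero (suc m) = refl

τ-suc : ∀ m a → τ m (suc a) ℕ.+ m ≡ τ m a ℕ.+ suc a
τ-suc zero    a       = ℕₚ.+-identityʳ (triangle (suc a))
τ-suc (suc m) zero    = trans (cong (ℕ._+ suc m) (τ-zero m)) (step m)
  where
  step : ∀ m → triangle (ℕ.pred m) ℕ.+ suc m ≡ triangle m ℕ.+ 1
  step zero    = refl
  step (suc m) = trans (ℕₚ.+-suc (triangle m) (suc m)) (ℕₚ.+-comm 1 (triangle m ℕ.+ suc m))
τ-suc (suc m) (suc a) = begin
  τ m (suc a) ℕ.+ suc m      ≡⟨ ℕₚ.+-suc (τ m (suc a)) m ⟩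
  suc (τ m (suc a) ℕ.+ m)    ≡⟨ cong suc (τ-suc m a) ⟩
  suc (τ m a ℕ.+ suc a)      ≡⟨ ℕₚ.+-suc (τ m a) (suc a) ⟨
  τ m a ℕ.+ suc (suc a)      ∎
  where open ≡-Reasoning

τ-≤ : ∀ m a → a ≤ m → τ m a ≡ triangle (ℕ.pred (m ∸ a))
τ-≤ m       zero    _         = τ-zero m
τ-≤ (suc m) (suc a) (s≤s a≤m) = τ-≤ m a a≤m

τ-+ : ∀ m j → τ m (m ℕ.+ j) ≡ triangle j
τ-+ zero    j = refl
τ-+ (suc m) j = τ-+ m j

m≤1+τ+a : ∀ m a → m ≤ suc (τ m a) ℕ.+ a
m≤1+τ+a zero    a       = z≤n
m≤1+τ+a (suc m) zero    = s≤s (ℕₚ.≤-trans (n≤triangle m) (ℕₚ.m≤m+n (triangle m) 0))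
m≤1+τ+a (suc m) (suc a) = subst (suc m ≤_) (sym (ℕₚ.+-suc (suc (τ m a)) a)) (s≤s (m≤1+τ+a m a))

a≤τ+m : ∀ m a → a ≤ τ m a ℕ.+ m
a≤τ+m zero    a       = subst (a ≤_) (sym (ℕₚ.+-identityʳ (triangle a))) (n≤triangle a)
a≤τ+m (suc m) zero    = z≤n
a≤τ+m (suc m) (suc a) = subst (suc a ≤_) (sym (ℕₚ.+-suc (τ m a) m)) (s≤s (a≤τ+m m a))

τ-antidiagonal : ∀ m n a b → a ℕ.+ b ≡ m ℕ.+ n → b ℕ.+ τ m (suc a) ≡ suc n ℕ.+ τ m a
τ-antidiagonal m n a b a+b≡m+n = ℕₚ.+-cancelʳ-≡ m (b ℕ.+ τ m (suc a)) (suc n ℕ.+ τ m a) (begin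
  b ℕ.+ τ m (suc a) ℕ.+ m       ≡⟨ ℕₚ.+-assoc b (τ m (suc a)) m ⟩
  b ℕ.+ (τ m (suc a) ℕ.+ m)     ≡⟨ cong (b ℕ.+_) (τ-suc m a) ⟩
  b ℕ.+ (τ m a ℕ.+ suc a)       ≡⟨ regroup b (τ m a) a ⟩
  τ m a ℕ.+ suc (a ℕ.+ b)       ≡⟨ cong (λ x → τ m a ℕ.+ suc x) a+b≡m+n ⟩
  τ m a ℕ.+ suc (m ℕ.+ n)       ≡⟨ regroup′ (τ m a) m n ⟩
  suc n ℕ.+ τ m a ℕ.+ m         ∎)
  where
  open ≡-Reasoning
  regroup : ∀ b t a → b ℕ.+ (t ℕ.+ suc a) ≡ t ℕ.+ suc (a ℕ.+ b)
  regroup = solve-∀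
  regroup′ : ∀ t m n → t ℕ.+ suc (m ℕ.+ n) ≡ suc n ℕ.+ t ℕ.+ m
  regroup′ = solve-∀

triangle-antidiagonal : ∀ N a b → a ℕ.+ b ≡ N → b ℕ.+ triangle a ≡ N ℕ.+ triangle (ℕ.pred a)
triangle-antidiagonal N zero    b refl = refl
triangle-antidiagonal N (suc a) b refl = regroup b (triangle a) a
  where
  regroup : ∀ b t a → b ℕ.+ (t ℕ.+ suc a) ≡ suc a ℕ.+ b ℕ.+ t
  regroup = solve-∀

a<N⇒N<τ : ∀ N M a → suc (suc (N ℕ.+ N)) ≤ M → a < N → N < τ M a
a<N⇒N<τ N M a 2N+2≤M a<N = ℕₚ.≰⇒> (λ τ≤N → ℕₚ.<-irrefl refl (begin-strict
  N ℕ.+ N               <⟨ ℕₚ.≤-trans (ℕₚ.n≤1+n _) 2N+2≤M ⟩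
  M                     ≤⟨ m≤1+τ+a M a ⟩
  suc (τ M a) ℕ.+ a     ≤⟨ ℕₚ.+-mono-≤-< τ≤N a<N ⟩
  N ℕ.+ N               ∎))
  where open ℕₚ.≤-Reasoning

b<N⇒N<τ : ∀ N M a b → suc (suc (N ℕ.+ N)) ≤ M → a ℕ.+ b ≡ M ℕ.+ M → b < N → N < τ M a
b<N⇒N<τ N M a b 2N+2≤M a+b≡M+M b<N = ℕₚ.≰⇒> (λ τ≤N → ℕₚ.<-irrefl refl (begin-strict
  N ℕ.+ N               <⟨ ℕₚ.≤-trans (ℕₚ.n≤1+n _) 2N+2≤M ⟩
  M                     <⟨ ℕₚ.+-cancelˡ-< M M (N ℕ.+ N) (M+M<M+2N τ≤N) ⟩
  N ℕ.+ N               ∎))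
  where
  M+M<M+2N : τ M a ≤ N → M ℕ.+ M < M ℕ.+ (N ℕ.+ N)
  M+M<M+2N τ≤N = begin-strict
    M ℕ.+ M               ≡⟨ a+b≡M+M ⟨
    a ℕ.+ b               ≤⟨ ℕₚ.+-monoˡ-≤ b (ℕₚ.≤-trans (a≤τ+m M a) (ℕₚ.+-monoˡ-≤ M τ≤N)) ⟩
    N ℕ.+ M ℕ.+ b         <⟨ ℕₚ.+-monoʳ-< (N ℕ.+ M) b<N ⟩
    N ℕ.+ M ℕ.+ N         ≡⟨ regroup N M ⟩
    M ℕ.+ (N ℕ.+ N)       ∎
    where
    open ℕₚ.≤-Reasoning
    regroup : ∀ N M → N ℕ.+ M ℕ.+ N ≡ M ℕ.+ (N ℕ.+ N)
    regroup = solve-∀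
  open ℕₚ.≤-Reasoning

-- Gaussian binomial coefficients and the finite triple product

-- gaussBinomial a b is the q-binomial coefficient [a+b choose a].
gaussBinomial : ℕ → ℕ → Series
gaussBinomial zero    b       = one
gaussBinomial (suc a) zero    = one
gaussBinomial (suc a) (suc b) = gaussBinomial (suc a) b ⊕ q^ suc b ⊛ gaussBinomial a (suc b)

-- [a+b-1 choose a-1], which is 0 for a = 0.
gaussBinomial′ : ℕ → ℕ → Series
gaussBinomial′ zero    b = 0ₛ
gaussBinomial′ (suc a) b = gaussBinomial a b

gaussBinomial-zero : ∀ a → gaussBinomial a 0 ≐ one
gaussBinomial-zero zero    = ≐-refl
gaussBinomial-zero (suc a) = ≐-refl

gaussBinomial-pascal : ∀ a b → gaussBinomial a (suc b) ≐ gaussBinomial a b ⊕ q^ suc b ⊛ gaussBinomial′ a (suc b)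
gaussBinomial-pascal zero    b = mk≐ λ n → sym (trans (cong (one n +_) (q^b⊛0 n)) (ℤₚ.+-identityʳ (one n)))
  where
  q^b⊛0 : ∀ n → (q^ suc b ⊛ 0ₛ) n ≡ 0ℤ
  q^b⊛0 n = sumTo-zero n (λ k _ → ℤₚ.*-zeroʳ ((q^ suc b) k))
gaussBinomial-pascal (suc a) b = ≐-refl

poch-⊛-gaussBinomial : ∀ a b → poch a ⊛ poch b ⊛ gaussBinomial a b ≐ poch (a ℕ.+ b)
poch-⊛-gaussBinomial zero    b = ≐-trans (⊛-identityʳ (one ⊛ poch b)) (⊛-identityˡ (poch b))
poch-⊛-gaussBinomial (suc a) zero rewrite ℕₚ.+-identityʳ a = ≐-trans (⊛-identityʳ _) (⊛-identityʳ _)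
poch-⊛-gaussBinomial (suc a) (suc b) = begin
  pa ⊛ (one ⊖ fa) ⊛ (pb ⊛ (one ⊖ fb)) ⊛ (g₁ ⊕ fb ⊛ g₂)
    ≐⟨ solve 6 (λ pa pb fa fb g₁ g₂ → pa :* (con 1ℤ :- fa) :* (pb :* (con 1ℤ :- fb)) :* (g₁ :+ fb :* g₂)
         := (con 1ℤ :- fb) :* (pa :* (con 1ℤ :- fa) :* pb :* g₁) :+ fb :* (con 1ℤ :- fa) :* (pa :* (pb :* (con 1ℤ :- fb)) :* g₂))
         ≐-refl pa pb fa fb g₁ g₂ ⟩
  (one ⊖ fb) ⊛ (poch (suc a) ⊛ pb ⊛ g₁) ⊕ fb ⊛ (one ⊖ fa) ⊛ (pa ⊛ poch (suc b) ⊛ g₂)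
    ≐⟨ ⊕-cong (⊛-cong (≐-refl {one ⊖ fb}) (≐-trans (poch-⊛-gaussBinomial (suc a) b) (≐-reflexive (cong poch (sym (ℕₚ.+-suc a b))))))
              (⊛-cong (≐-refl {fb ⊛ (one ⊖ fa)}) (poch-⊛-gaussBinomial a (suc b))) ⟩
  (one ⊖ fb) ⊛ X ⊕ fb ⊛ (one ⊖ fa) ⊛ X
    ≐⟨ solve 3 (λ fa fb x → (con 1ℤ :- fb) :* x :+ fb :* (con 1ℤ :- fa) :* x := x :* (con 1ℤ :- fb :* fa)) ≐-refl fa fb X ⟩
  X ⊛ (one ⊖ fb ⊛ fa)
    ≐⟨ ⊛-cong (≐-refl {X}) (⊖-cong (≐-refl {one}) (≐-trans (q^-+ (suc b) (suc a)) (q^-cong exponent))) ⟩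
  poch (suc a ℕ.+ suc b) ∎
  where
  open ≐-Reasoning
  pa pb fa fb g₁ g₂ X : Series
  pa = poch a
  pb = poch b
  fa = q^ suc a
  fb = q^ suc b
  g₁ = gaussBinomial (suc a) b
  g₂ = gaussBinomial a (suc b)
  X = poch (a ℕ.+ suc b)
  exponent : suc b ℕ.+ suc a ≡ suc (a ℕ.+ suc b)
  exponent = cong suc (trans (ℕₚ.+-suc b a) (trans (cong suc (ℕₚ.+-comm b a)) (sym (ℕₚ.+-suc a b))))

gaussBinomial-comm : ∀ a b → gaussBinomial a b ≐ gaussBinomial b a
gaussBinomial-comm a b = ⊛-cancelˡ {poch a ⊛ poch b} (cong₂ _*_ (poch-constant-term a) (poch-constant-term b)) (begin
  poch a ⊛ poch b ⊛ gaussBinomial a b  ≐⟨ poch-⊛-gaussBinomial a b ⟩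
  poch (a ℕ.+ b)                       ≐⟨ ≐-reflexive (cong poch (ℕₚ.+-comm a b)) ⟩
  poch (b ℕ.+ a)                       ≐⟨ ≐-sym (poch-⊛-gaussBinomial b a) ⟩
  poch b ⊛ poch a ⊛ gaussBinomial b a  ≐⟨ ⊛-cong (⊛-comm (poch b) (poch a)) (≐-refl {gaussBinomial b a}) ⟩
  poch a ⊛ poch b ⊛ gaussBinomial b a  ∎)
  where open ≐-Reasoning

antidiagonalₛ : ℕ → (ℕ → ℕ → Series) → Series
antidiagonalₛ N h i = antidiagonal N (λ a b → h a b i)

antidiagonalₛ-cong : ∀ N {h h′} → (∀ a b → a ℕ.+ b ≡ N → h a b ≐ h′ a b) → antidiagonalₛ N h ≐ antidiagonalₛ N h′
antidiagonalₛ-cong N h≐h′ = mk≐ λ i → antidiagonal-cong N (λ a b a+b≡N → at (h≐h′ a b a+b≡N) i)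

antidiagonalₛ-cong≈ : ∀ N {h h′ M} → (∀ a b → a ℕ.+ b ≡ N → h a b ≈[ M ] h′ a b) →
                      antidiagonalₛ N h ≈[ M ] antidiagonalₛ N h′
antidiagonalₛ-cong≈ N h≈h′ = mk≈ λ i i≤M → antidiagonal-cong N (λ a b a+b≡N → at≈ (h≈h′ a b a+b≡N) i i≤M)

antidiagonalₛ-⊛ : ∀ N c h → c ⊛ antidiagonalₛ N h ≐ antidiagonalₛ N (λ a b → c ⊛ h a b)
antidiagonalₛ-⊛ N c h = sumₛ-⊛ N c (λ a → h a (N ∸ a))

binomialSum : ℕ → (ℕ → Series) → Series
binomialSum N W = antidiagonalₛ N (λ a b → gaussBinomial a b ⊛ W a)

binomialSum-pascal : ∀ N (W : ℕ → Series) →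
  binomialSum (suc N) W ≐ binomialSum N W ⊕ antidiagonalₛ N (λ a b → q^ b ⊛ gaussBinomial a b ⊛ W (suc a))
binomialSum-pascal N W = begin
  antidiagonalₛ (suc N) GW
    ≐⟨ mk≐ (λ i → antidiagonal-last N (λ a b → GW a b i)) ⟩
  antidiagonalₛ N (λ a b → GW a (suc b)) ⊕ GW (suc N) 0
    ≐⟨ ⊕-cong (antidiagonalₛ-cong N (λ a b _ → ≐-trans (⊛-cong (gaussBinomial-pascal a b) (≐-refl {W a}))
                                                         (⊛-distribʳ (W a) (gaussBinomial a b) _)))
              (≐-trans (⊛-cong (gaussBinomial-zero (suc N)) (≐-refl {W (suc N)}))
                       (≐-trans (⊛-identityˡ (W (suc N))) (≐-sym K-last))) ⟩
  antidiagonalₛ N (λ a b → GW a b ⊕ K a (suc b)) ⊕ K (suc N) 0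
    ≐⟨ ⊕-cong (mk≐ λ i → antidiagonal-distrib-+ N (λ a b → GW a b i) (λ a b → K a (suc b) i)) (≐-refl {K (suc N) 0}) ⟩
  antidiagonalₛ N GW ⊕ antidiagonalₛ N (λ a b → K a (suc b)) ⊕ K (suc N) 0
    ≐⟨ mk≐ (λ i → ℤₚ.+-assoc (antidiagonalₛ N GW i) _ _) ⟩
  antidiagonalₛ N GW ⊕ (antidiagonalₛ N (λ a b → K a (suc b)) ⊕ K (suc N) 0)
    ≐⟨ ⊕-cong (≐-refl {antidiagonalₛ N GW})
              (mk≐ λ i → trans (sym (antidiagonal-last N (λ a b → K a b i))) (antidiagonal-first N (λ a b → K a b i))) ⟩
  antidiagonalₛ N GW ⊕ (K 0 (suc N) ⊕ antidiagonalₛ N (λ a b → K (suc a) b))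
    ≐⟨ ⊕-cong (≐-refl {antidiagonalₛ N GW}) (mk≐ λ i → trans (cong (_+ tail i) (K-zero i)) (ℤₚ.+-identityˡ (tail i))) ⟩
  antidiagonalₛ N GW ⊕ antidiagonalₛ N (λ a b → K (suc a) b) ∎
  where
  open ≐-Reasoning
  GW : ℕ → ℕ → Series
  GW a b = gaussBinomial a b ⊛ W a
  K : ℕ → ℕ → Series
  K a b = q^ b ⊛ gaussBinomial′ a b ⊛ W a
  K-last : K (suc N) 0 ≐ W (suc N)
  K-last = ≐-trans (⊛-cong (≐-trans (⊛-cong (≐-refl {one}) (gaussBinomial-zero N)) (⊛-identityˡ one)) (≐-refl {W (suc N)}))
                   (⊛-identityˡ (W (suc N)))
  tail : Series
  tail = antidiagonalₛ N (λ a b → K (suc a) b)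
  K-zero : ∀ n → K 0 (suc N) n ≡ 0ℤ
  K-zero n = sumTo-zero n (λ k _ →
    trans (cong (_* W 0 (n ∸ k)) (sumTo-zero k (λ j _ → ℤₚ.*-zeroʳ ((q^ suc N) j)))) (ℤₚ.*-zeroˡ (W 0 (n ∸ k))))

binomialSum-suc : ∀ N (W : ℕ → Series) x → (∀ a b → a ℕ.+ b ≡ N → q^ b ⊛ W (suc a) ≐ x ⊛ W a) →
                  binomialSum (suc N) W ≐ (one ⊕ x) ⊛ binomialSum N W
binomialSum-suc N W x shift = begin
  binomialSum (suc N) W
    ≐⟨ binomialSum-pascal N W ⟩
  binomialSum N W ⊕ antidiagonalₛ N (λ a b → q^ b ⊛ gaussBinomial a b ⊛ W (suc a))
    ≐⟨ ⊕-cong (≐-refl {binomialSum N W}) (antidiagonalₛ-cong N shifted) ⟩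
  binomialSum N W ⊕ antidiagonalₛ N (λ a b → x ⊛ (gaussBinomial a b ⊛ W a))
    ≐⟨ ⊕-cong (≐-refl {binomialSum N W}) (≐-sym (antidiagonalₛ-⊛ N x (λ a b → gaussBinomial a b ⊛ W a))) ⟩
  binomialSum N W ⊕ x ⊛ binomialSum N W
    ≐⟨ solve 2 (λ s x → s :+ x :* s := (con 1ℤ :+ x) :* s) ≐-refl (binomialSum N W) x ⟩
  (one ⊕ x) ⊛ binomialSum N W ∎
  where
  open ≐-Reasoning
  shifted : ∀ a b → a ℕ.+ b ≡ N → q^ b ⊛ gaussBinomial a b ⊛ W (suc a) ≐ x ⊛ (gaussBinomial a b ⊛ W a)
  shifted a b a+b≡N = begin
    q^ b ⊛ gaussBinomial a b ⊛ W (suc a)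
      ≐⟨ solve 3 (λ q g w → q :* g :* w := g :* (q :* w)) ≐-refl (q^ b) (gaussBinomial a b) (W (suc a)) ⟩
    gaussBinomial a b ⊛ (q^ b ⊛ W (suc a))
      ≐⟨ ⊛-cong (≐-refl {gaussBinomial a b}) (shift a b a+b≡N) ⟩
    gaussBinomial a b ⊛ (x ⊛ W a)
      ≐⟨ solve 3 (λ g x w → g :* (x :* w) := x :* (g :* w)) ≐-refl (gaussBinomial a b) x (W a) ⟩
    x ⊛ (gaussBinomial a b ⊛ W a) ∎

negPoch₀ : ℕ → Series
negPoch₀ N = finProd N (factor -1ℤ)

q-binomial-theorem : ∀ N → binomialSum N (λ a → q^ triangle (ℕ.pred a)) ≐ negPoch₀ N
q-binomial-theorem zero    = ⊛-identityˡ one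
q-binomial-theorem (suc N) = begin
  binomialSum (suc N) W
    ≐⟨ binomialSum-suc N W (q^ N) (λ a b a+b≡N →
         ≐-trans (q^-+ b (triangle a)) (≐-trans (q^-cong (triangle-antidiagonal N a b a+b≡N)) (≐-sym (q^-+ N _)))) ⟩
  (one ⊕ q^ N) ⊛ binomialSum N W  ≐⟨ ⊛-cong (≐-sym (factor-neg N)) (q-binomial-theorem N) ⟩
  factor -1ℤ N ⊛ negPoch₀ N       ≐⟨ ⊛-comm (factor -1ℤ N) (negPoch₀ N) ⟩
  negPoch₀ (suc N)                ∎
  where
  open ≐-Reasoning
  W : ℕ → Series
  W a = q^ triangle (ℕ.pred a)

finite-triple-product : ∀ m n → binomialSum (m ℕ.+ n) (λ a → q^ τ m a) ≐ negPoch n ⊛ negPoch₀ m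
finite-triple-product m zero rewrite ℕₚ.+-identityʳ m = begin
  antidiagonalₛ m (λ a b → gaussBinomial a b ⊛ q^ τ m a)
    ≐⟨ antidiagonalₛ-cong m (λ a b a+b≡m → ⊛-cong (≐-refl {gaussBinomial a b}) (q^-cong (τ-small a b a+b≡m))) ⟩
  antidiagonalₛ m (λ a b → gaussBinomial a b ⊛ q^ triangle (ℕ.pred b))
    ≐⟨ mk≐ (λ i → antidiagonal-swap m (λ a b → (gaussBinomial a b ⊛ q^ triangle (ℕ.pred b)) i)) ⟩
  antidiagonalₛ m (λ a b → gaussBinomial b a ⊛ q^ triangle (ℕ.pred a))
    ≐⟨ antidiagonalₛ-cong m (λ a b _ → ⊛-cong (gaussBinomial-comm b a) (≐-refl {q^ triangle (ℕ.pred a)})) ⟩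
  binomialSum m (λ a → q^ triangle (ℕ.pred a))
    ≐⟨ q-binomial-theorem m ⟩
  negPoch₀ m
    ≐⟨ ≐-sym (⊛-identityˡ (negPoch₀ m)) ⟩
  one ⊛ negPoch₀ m ∎
  where
  open ≐-Reasoning
  τ-small : ∀ a b → a ℕ.+ b ≡ m → τ m a ≡ triangle (ℕ.pred b)
  τ-small a b refl = trans (τ-≤ (a ℕ.+ b) a (ℕₚ.m≤m+n a b)) (cong (triangle ∘ ℕ.pred) (ℕₚ.m+n∸m≡n a b))
finite-triple-product m (suc n) rewrite ℕₚ.+-suc m n = begin
  binomialSum (suc (m ℕ.+ n)) W
    ≐⟨ binomialSum-suc (m ℕ.+ n) W (q^ suc n) (λ a b a+b≡m+n →
         ≐-trans (q^-+ b (τ m (suc a))) (≐-trans (q^-cong (τ-antidiagonal m n a b a+b≡m+n)) (≐-sym (q^-+ (suc n) (τ m a))))) ⟩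
  (one ⊕ q^ suc n) ⊛ binomialSum (m ℕ.+ n) W
    ≐⟨ ⊛-cong (≐-sym (factor-neg (suc n))) (finite-triple-product m n) ⟩
  factor -1ℤ (suc n) ⊛ (negPoch n ⊛ negPoch₀ m)
    ≐⟨ solve 3 (λ f x y → f :* (x :* y) := x :* f :* y) ≐-refl (factor -1ℤ (suc n)) (negPoch n) (negPoch₀ m) ⟩
  negPoch (suc n) ⊛ negPoch₀ m ∎
  where
  open ≐-Reasoning
  W : ℕ → Series
  W a = q^ τ m a

-- Gauss's identity ψ = (-q;q)∞ (q²;q²)∞

poch∞-≈poch : ∀ {N K} → N ≤ K → poch∞ 1 ≈[ N ] poch K
poch∞-≈poch {N} {K} = prod∞-≈finProd (pochInf-multipliable 1ℤ 0) N K

negPoch∞-≈negPoch : ∀ {N K} → N ≤ K → negPoch∞ 1 ≈[ N ] negPoch K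
negPoch∞-≈negPoch {N} {K} = prod∞-≈finProd (pochInf-multipliable -1ℤ 0) N K

poch∞-⊛-gaussBinomial : ∀ {N a b} → N ≤ a → N ≤ b → poch∞ 1 ⊛ gaussBinomial a b ≈[ N ] one
poch∞-⊛-gaussBinomial {N} {a} {b} N≤a N≤b = ⊛-cancelˡ-≈ {poch a} (poch-constant-term a) (begin
  poch a ⊛ (poch∞ 1 ⊛ gaussBinomial a b)  ≈⟨ ⊛-cong≈ (≈-refl {poch a}) (⊛-cong≈ (poch∞-≈poch N≤b) (≈-refl {gaussBinomial a b})) ⟩
  poch a ⊛ (poch b ⊛ gaussBinomial a b)   ≐⟨ ≐-sym (⊛-assoc (poch a) (poch b) (gaussBinomial a b)) ⟩
  poch a ⊛ poch b ⊛ gaussBinomial a b     ≐⟨ poch-⊛-gaussBinomial a b ⟩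
  poch (a ℕ.+ b)                          ≈⟨ poch∞-≈poch (ℕₚ.≤-trans N≤a (ℕₚ.m≤m+n a b)) ⟨
  poch∞ 1                                 ≈⟨ poch∞-≈poch N≤a ⟩
  poch a                                  ≐⟨ ≐-sym (⊛-identityʳ (poch a)) ⟩
  poch a ⊛ one                            ∎)
  where open ≈-Reasoning

-- Multiplied by (q;q)∞, the terms with a or b below N are negligible since then q^(N+1) ∣ q^τ M a,
-- and the others tend to q^τ M a.
poch∞-⊛-binomialSum : ∀ N M → suc (suc (N ℕ.+ N)) ≤ M →
  poch∞ 1 ⊛ binomialSum (M ℕ.+ M) (λ a → q^ τ M a) ≈[ N ] sumₛ (M ℕ.+ M) (λ a → q^ τ M a)
poch∞-⊛-binomialSum N M 2N+2≤M =
  ≈-trans (≐⇒≈ (antidiagonalₛ-⊛ (M ℕ.+ M) (poch∞ 1) (λ a b → gaussBinomial a b ⊛ q^ τ M a)))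
          (antidiagonalₛ-cong≈ (M ℕ.+ M) term)
  where
  negligible : ∀ a b → N < τ M a → poch∞ 1 ⊛ (gaussBinomial a b ⊛ q^ τ M a) ≈[ N ] q^ τ M a
  negligible a b N<τ = q^∣⇒≈ (q^∣-⊛ʳ (poch∞ 1) (q^∣-⊛ʳ (gaussBinomial a b) q^N+1∣q^τ)) q^N+1∣q^τ
    where
    q^N+1∣q^τ : q^ suc N ∣ q^ τ M a
    q^N+1∣q^τ = q^∣-weaken N<τ (q^∣mono 1ℤ (τ M a))
  term : ∀ a b → a ℕ.+ b ≡ M ℕ.+ M → poch∞ 1 ⊛ (gaussBinomial a b ⊛ q^ τ M a) ≈[ N ] q^ τ M a
  term a b a+b≡2M with N ℕ.≤? a | N ℕ.≤? b
  ... | yes N≤a | yes N≤b = begin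
    poch∞ 1 ⊛ (gaussBinomial a b ⊛ q^ τ M a)  ≐⟨ ≐-sym (⊛-assoc (poch∞ 1) (gaussBinomial a b) (q^ τ M a)) ⟩
    poch∞ 1 ⊛ gaussBinomial a b ⊛ q^ τ M a    ≈⟨ ⊛-cong≈ (poch∞-⊛-gaussBinomial N≤a N≤b) (≈-refl {q^ τ M a}) ⟩
    one ⊛ q^ τ M a                            ≐⟨ ⊛-identityˡ (q^ τ M a) ⟩
    q^ τ M a                                  ∎
    where open ≈-Reasoning
  ... | no N≰a | _        = negligible a b (a<N⇒N<τ N M a 2N+2≤M (ℕₚ.≰⇒> N≰a))
  ... | yes _  | no N≰b   = negligible a b (b<N⇒N<τ N M a b 2N+2≤M a+b≡2M (ℕₚ.≰⇒> N≰b))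

triangleSum≈psi : ∀ {N K} → N ≤ K → sumₛ K (λ d → q^ triangle d) ≈[ N ] psi
triangleSum≈psi {N} {K} N≤K = mk≈ λ i i≤N → begin
  sumTo K (λ d → (q^ triangle d) i)  ≡⟨ sumTo-truncate i K (ℕₚ.≤-trans i≤N N≤K) (λ d i<d _ → vanishes (q^∣triangle d) i i<d) ⟩
  sumTo i (λ d → (q^ triangle d) i)  ≡⟨ sumTo-cong i (λ d _ → cong (λ e → mono 1ℤ e i) (⌊n[n+1]/2⌋≡triangle d)) ⟨
  psi i                              ∎
  where
  open ≡-Reasoning
  q^∣triangle : ∀ d → q^ d ∣ q^ triangle d
  q^∣triangle d = q^∣-weaken (n≤triangle d) (q^∣mono 1ℤ (triangle d))

-- The exponents τ M a for a = 0 … 2M run through the triangular numbers twice.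
τ-sum≈psi+psi : ∀ {N M} → N ≤ M → sumₛ (suc M ℕ.+ suc M) (λ a → q^ τ (suc M) a) ≈[ N ] psi ⊕ psi
τ-sum≈psi+psi {N} {M} N≤M = mk≈ λ i i≤N → begin
  sumTo (suc (M ℕ.+ suc M)) (λ a → (q^ τ (suc M) a) i)
    ≡⟨ sumTo-+ M (suc M) (λ a → (q^ τ (suc M) a) i) ⟩
  sumTo M (λ a → (q^ τ (suc M) a) i) + sumTo (suc M) (λ j → (q^ τ (suc M) (suc M ℕ.+ j)) i)
    ≡⟨ cong₂ _+_ (sumTo-cong M (λ a a≤M → cong (λ e → (q^ e) i) (τ-below a a≤M)))
                 (sumTo-cong (suc M) (λ j _ → cong (λ e → (q^ e) i) (τ-+ (suc M) j))) ⟩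
  sumTo M (λ a → (q^ triangle (M ∸ a)) i) + sumTo (suc M) (λ j → (q^ triangle j) i)
    ≡⟨ cong (_+ sumTo (suc M) (λ j → (q^ triangle j) i)) (antidiagonal-swap M (λ _ d → (q^ triangle d) i)) ⟩
  sumTo M (λ d → (q^ triangle d) i) + sumTo (suc M) (λ j → (q^ triangle j) i)
    ≡⟨ cong₂ _+_ (at≈ (triangleSum≈psi N≤M) i i≤N) (at≈ (triangleSum≈psi (ℕₚ.m≤n⇒m≤1+n N≤M)) i i≤N) ⟩
  psi i + psi i ∎
  where
  open ≡-Reasoning
  τ-below : ∀ a → a ≤ M → τ (suc M) a ≡ triangle (M ∸ a)
  τ-below a a≤M = trans (τ-≤ (suc M) a (ℕₚ.m≤n⇒m≤1+n a≤M)) (cong (triangle ∘ ℕ.pred) (ℕₚ.+-∸-assoc 1 a≤M))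

poch∞-⊛-tripleProduct : ∀ {N M} → N ≤ M →
  poch∞ 1 ⊛ (negPoch (suc M) ⊛ negPoch₀ (suc M)) ≈[ N ] gaussProduct ⊕ gaussProduct
poch∞-⊛-tripleProduct {N} {M} N≤M = begin
  poch∞ 1 ⊛ (negPoch (suc M) ⊛ negPoch₀ (suc M))
    ≐⟨ ⊛-cong (≐-refl {poch∞ 1}) (⊛-cong (≐-refl {negPoch (suc M)}) (finProd-+ 1 M (factor -1ℤ))) ⟩
  poch∞ 1 ⊛ (negPoch (suc M) ⊛ (one ⊛ factor -1ℤ 0 ⊛ negPoch M))
    ≈⟨ ⊛-cong≈ (≈-refl {poch∞ 1}) (⊛-cong≈ (negPoch∞-≈negPoch (ℕₚ.m≤n⇒m≤1+n N≤M))
                                          (⊛-cong≈ (≈-refl {one ⊛ factor -1ℤ 0}) (negPoch∞-≈negPoch N≤M))) ⟨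
  poch∞ 1 ⊛ (negPoch∞ 1 ⊛ (one ⊛ factor -1ℤ 0 ⊛ negPoch∞ 1))
    ≐⟨ ⊛-cong (≐-refl {poch∞ 1}) (⊛-cong (≐-refl {negPoch∞ 1}) (⊛-cong (≐-trans (⊛-identityˡ _) 1+q⁰≐2) (≐-refl {negPoch∞ 1}))) ⟩
  poch∞ 1 ⊛ (negPoch∞ 1 ⊛ (const (ℤ.+ 2) ⊛ negPoch∞ 1))
    ≐⟨ solve 2 (λ p e → p :* (e :* (con (ℤ.+ 2) :* e)) := e :* (e :* p) :+ e :* (e :* p)) ≐-refl (poch∞ 1) (negPoch∞ 1) ⟩
  negPoch∞ 1 ⊛ (negPoch∞ 1 ⊛ poch∞ 1) ⊕ negPoch∞ 1 ⊛ (negPoch∞ 1 ⊛ poch∞ 1)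
    ≐⟨ ⊕-cong (⊛-cong (≐-refl {negPoch∞ 1}) (negPoch∞-⊛-poch∞ 0)) (⊛-cong (≐-refl {negPoch∞ 1}) (negPoch∞-⊛-poch∞ 0)) ⟩
  gaussProduct ⊕ gaussProduct ∎
  where
  open ≈-Reasoning
  1+q⁰≐2 : factor -1ℤ 0 ≐ const (ℤ.+ 2)
  1+q⁰≐2 = mk≐ λ { zero → refl ; (suc n) → refl }

gauss-identity : psi ≐ gaussProduct
gauss-identity = mk≐ λ N → halve (at≈ (psi+psi≈ N) N ℕₚ.≤-refl)
  where
  halve : ∀ {x y} → x + x ≡ y + y → x ≡ y
  halve {x} {y} x+x≡y+y = ℤₚ.*-cancelˡ-≡ (ℤ.+ 2) x y (trans (twice x) (trans x+x≡y+y (sym (twice y))))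
    where
    twice : ∀ z → ℤ.+ 2 * z ≡ z + z
    twice z = trans (ℤₚ.*-distribʳ-+ z 1ℤ 1ℤ) (cong₂ _+_ (ℤₚ.*-identityˡ z) (ℤₚ.*-identityˡ z))
  psi+psi≈ : ∀ N → psi ⊕ psi ≈[ N ] gaussProduct ⊕ gaussProduct
  psi+psi≈ N = begin
    psi ⊕ psi                                              ≈⟨ τ-sum≈psi+psi N≤M ⟨
    sumₛ (M ℕ.+ M) (λ a → q^ τ M a)                        ≈⟨ poch∞-⊛-binomialSum N M ℕₚ.≤-refl ⟨
    poch∞ 1 ⊛ binomialSum (M ℕ.+ M) (λ a → q^ τ M a)       ≐⟨ ⊛-cong (≐-refl {poch∞ 1}) (finite-triple-product M M) ⟩
    poch∞ 1 ⊛ (negPoch M ⊛ negPoch₀ M)                     ≈⟨ poch∞-⊛-tripleProduct N≤M ⟩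
    gaussProduct ⊕ gaussProduct                            ∎
    where
    open ≈-Reasoning
    M : ℕ
    M = suc (suc (N ℕ.+ N))
    N≤M : N ≤ suc (N ℕ.+ N)
    N≤M = ℕₚ.m≤n⇒m≤1+n (ℕₚ.m≤m+n N N)

theorem1p4 : ∀ (N : ℕ) → B′ N ≡ (psi ⊛ psi ⊖ psi) N
theorem1p4 = at (begin
  B′                                          ≐⟨ B′-product ⟩
  gaussProduct ⊛ gaussProduct ⊖ gaussProduct ≐⟨ ≐-sym (⊖-cong (⊛-cong gauss-identity gauss-identity) gauss-identity) ⟩
  psi ⊛ psi ⊖ psi                             ∎)
  where open ≐-Reasoning
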